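{- Let $\mathcal{X}=(V,S)$ be a Higmanian scheme and let $S=\{s_0,s_1,s_2,s_3,s_4\}$ be a standard ordering of $S$, with nontrivial parabolics $e_0=s_0\cup s_1$ and $e_1=s_0\cup s_1\cup s_2$. Let $i\in\{3,4\}$ and let $\Gamma$ be the graph with vertex set $V$ and edge set $E=s_2\cup s_i$. Then $\Gamma$ is a divisible design graph if and only if $c_{33}^3=c_{33}^4$ and at least one of the following two equalities holds: $$\text{(A)}\quad \frac{1}{n_3}+\frac{1}{n_4}=\frac{1}{n_1}-\frac{1}{n_1+1};\qquad\qquad \text{(B)}\quad \frac{n_2}{n_1+1}-\frac{2n_i}{n_{7-i}}=1.$$ Moreover, the canonical partition of $\Gamma$ is the partition of $V$ into the classes of $e_1$ whenever (A) holds, and into the classes of $e_0$ whenever (B) holds; and $\Gamma$ is a proper divisible design graph if and only if exactly one of (A) and (B) holds.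
   Context: An association scheme on a finite set $V$ is a pair $\mathcal{X}=(V,S)$, where $S$ is a partition of $V^2$ such that the diagonal $\mathbf{1}_V=\{(x,x):x\in V\}$ belongs to $S$, $s^*=\{(y,x):(x,y)\in s\}\in S$ for all $s\in S$, and for all $r,s,t\in S$ the number $c_{rs}^t=|xr\cap ys^*|$ (where $xr=\{y:(x,y)\in r\}$) does not depend on the choice of $(x,y)\in t$. Elements of $S$ are called basis relations. The valency of a union $r$ of basis relations is $n_r=|xr|$ (independent of $x\in V$). A parabolic is an equivalence relation on $V$ which is a union of basis relations. For a relation $s\subseteq V^2$, $\mathrm{rad}(s)$ denotes the largest relation $r\subseteq V^2$ with $rs=sr=s$ (composition of relations). The scheme $\mathcal{X}$ is Higmanian if: $|S|=5$; $s^*=s$ for every $s\in S$; there exist $s_1,s_2\in S$ such that $e_0=\mathbf{1}_V\cup s_1$ and $e_1=\mathbf{1}_V\cup s_1\cup s_2$ are parabolics; and $\mathrm{rad}(s)=\mathbf{1}_V$ for every $s\in S$ not contained in $e_1$. (Then $e_0,e_1$ are the only parabolics other than $\mathbf{1}_V$ and $V^2$.) A standard ordering of $S$ is $S=\{s_0,\dots,s_4\}$ with $s_0=\mathbf{1}_V$, $s_1=e_0\setminus\mathbf{1}_V$, $s_2=e_1\setminus e_0$, and $n_3\le n_4$, where $n_j=n_{s_j}$; write $c_{jk}^l=c_{s_js_k}^{s_l}$. Graphs are simple, undirected, loopless. A regular graph $\Gamma$ of degree $k$ on a vertex set of size $v$ is a divisible design graph (DDG) with parameters $(v,k,\lambda_1,\lambda_2,m,n)$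 if its vertex set can be partitioned into $m$ classes, each of size $n$, such that any two distinct vertices in the same class have exactly $\lambda_1$ common neighbours and any two vertices in different classes have exactly $\lambda_2$ common neighbours; such a partition is called the canonical partition. A DDG is proper if $m,n>1$ and $\lambda_1\neq\lambda_2$. -}

module Defs where

open import Data.Nat using (ℕ; zero; suc; _+_; _*_; _≤_; _<_)
open import Data.Bool using (Bool; true; false; if_then_else_; _∧_; _∨_; T)
open import Data.Fin using (Fin; zero; suc; _≟_)
open import Data.Product using (Σ; _×_; _,_)
open import Data.Sum using (_⊎_)
open import Data.Integer using (+_)
open import Data.Rational using (ℚ; _/_; 0ℚ) renaming (_+_ to _+ℚ_; _-_ to _-ℚ_)
open import Relation.Nullary using (¬_; does)
open import Relation.Binary.PropositionalEquality using (_≡_; _≢_)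
open import Function.Bundles using (_⇔_)

count : ∀ {n} → (Fin n → Bool) → ℕ
count {zero}  p = 0
count {suc n} p = (if p zero then 1 else 0) + count (λ i → p (suc i))

_==_ : ∀ {n} → Fin n → Fin n → Bool
a == b = does (a ≟ b)

-- The partition S of V² is given by the colouring `col`:
-- (x , y) lies in the basis relation s iff col x y ≡ s.  By convention
-- the basis relation with index zero is the diagonal 1_V.

record AssocScheme (v k : ℕ) : Set where
  field
    col      : Fin v → Fin v → Fin (suc k)
    nonempty : ∀ s → Σ (Fin v) λ x → Σ (Fin v) λ y → col x y ≡ s
    diag     : ∀ x y → (col x y ≡ zero) ⇔ (x ≡ y)
    transp   : ∀ s → Σ (Fin (suc k)) λ t → ∀ x y → (col x y ≡ s) ⇔ (col y x ≡ t)
    -- intersection numbers c_{rs}^t = |x r ∩ y s*| for (x,y) ∈ t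
    inum     : Fin (suc k) → Fin (suc k) → Fin (suc k) → ℕ
    inum-spec : ∀ r s x y →
      count (λ z → (col x z == r) ∧ (col z y == s)) ≡ inum r s (col x y)
    val      : Fin (suc k) → ℕ
    val-spec : ∀ r x → count (λ y → col x y == r) ≡ val r

module _ {v k : ℕ} (X : AssocScheme v k) where
  open AssocScheme X

  inU : (Fin (suc k) → Bool) → Fin v → Fin v → Set
  inU P x y = T (P (col x y))

  IsParabolic : (Fin (suc k) → Bool) → Set
  IsParabolic P =
    (∀ x → inU P x x) ×
    (∀ x y → inU P x y → inU P y x) ×
    (∀ x y z → inU P x y → inU P y z → inU P x z)

  -- rad(s) = 1_V : every relation r ⊆ V² with r s = s r = s is
  -- contained in 1_V  (1_V itself always satisfies r s = s r = s).
  RadTrivial : Fin (suc k) → Set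
  RadTrivial s =
    (r : Fin v → Fin v → Bool) →
    (∀ x y → (Σ (Fin v) λ z → T (r x z) × (col z y ≡ s)) ⇔ (col x y ≡ s)) →
    (∀ x y → (Σ (Fin v) λ z → (col x z ≡ s) × T (r z y)) ⇔ (col x y ≡ s)) →
    ∀ x y → T (r x y) → x ≡ y

s0 s1 s2 s3 s4 : Fin 5
s0 = zero
s1 = suc zero
s2 = suc (suc zero)
s3 = suc (suc (suc zero))
s4 = suc (suc (suc (suc zero)))

inE0 : Fin 5 → Bool
inE0 t = (t == s0) ∨ (t == s1)

inE1 : Fin 5 → Bool
inE1 t = (t == s0) ∨ (t == s1) ∨ (t == s2)

-- A Higmanian scheme together with a standard ordering s0,…,s4 of S
-- (given by the indexing of the basis relations by Fin 5).
record IsHigmanianStd {v : ℕ} (X : AssocScheme v 4) : Set where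
  open AssocScheme X
  field
    symmetric : ∀ x y → col x y ≡ col y x
    e0-parabolic : IsParabolic X inE0
    e1-parabolic : IsParabolic X inE1
    rad3 : RadTrivial X s3
    rad4 : RadTrivial X s4
    n3≤n4 : val s3 ≤ val s4

module _ {v : ℕ} (adj : Fin v → Fin v → Bool) where

  IsGraph : Set
  IsGraph = (∀ x → adj x x ≡ false) × (∀ x y → adj x y ≡ adj y x)

  commonNbrs : Fin v → Fin v → ℕ
  commonNbrs x y = count (λ z → adj x z ∧ adj y z)

  record IsDDGWith (k λ₁ λ₂ m n : ℕ) (cls : Fin v → Fin m) : Set where
    field
      graph     : IsGraph
      regular   : ∀ x → count (adj x) ≡ k
      classSize : ∀ j → count (λ x → cls x == j) ≡ n
      sameClass : ∀ x y → x ≢ y → cls x ≡ cls y → commonNbrs x y ≡ λ₁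
      diffClass : ∀ x y → cls x ≢ cls y → commonNbrs x y ≡ λ₂

  IsDDGPart : (Fin v → Fin v → Set) → Set
  IsDDGPart Q =
    Σ ℕ λ k → Σ ℕ λ λ₁ → Σ ℕ λ λ₂ → Σ ℕ λ m → Σ ℕ λ n →
    Σ (Fin v → Fin m) λ cls → IsDDGWith k λ₁ λ₂ m n cls ×
      (∀ x y → (cls x ≡ cls y) ⇔ Q x y)

  IsDDG : Set
  IsDDG =
    Σ ℕ λ k → Σ ℕ λ λ₁ → Σ ℕ λ λ₂ → Σ ℕ λ m → Σ ℕ λ n →
    Σ (Fin v → Fin m) λ cls → IsDDGWith k λ₁ λ₂ m n cls

  IsProperDDG : Set
  IsProperDDG =
    Σ ℕ λ k → Σ ℕ λ λ₁ → Σ ℕ λ λ₂ → Σ ℕ λ m → Σ ℕ λ n →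
    Σ (Fin v → Fin m) λ cls → IsDDGWith k λ₁ λ₂ m n cls ×
      (1 < m) × (1 < n) × (λ₁ ≢ λ₂)

gammaAdj : ∀ {v} → AssocScheme v 4 → Fin 5 → Fin v → Fin v → Bool
gammaAdj X i x y = (AssocScheme.col X x y == s2) ∨ (AssocScheme.col X x y == i)

-- 7 - i for i ∈ {3,4}
other : Fin 5 → Fin 5
other t = if t == s3 then s4 else s3

-- Rational numbers a / b ; only used with b ≠ 0 (all valencies are
-- positive), the value for b = 0 is an irrelevant default.

frac : ℕ → ℕ → ℚ
frac a zero    = 0ℚ
frac a (suc b) = (+ a) / suc b

module _ {v : ℕ} (X : AssocScheme v 4) where
  open AssocScheme X

  CondA : Set
  CondA = frac 1 (val s3) +ℚ frac 1 (val s4)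
          ≡ frac 1 (val s1) -ℚ frac 1 (val s1 + 1)

  CondB : Fin 5 → Set
  CondB i = frac (val s2) (val s1 + 1) -ℚ frac (2 * val i) (val (other i))
            ≡ frac 1 1

module Submission where

-- Γ is a union of basis relations, so a pair of colour t has Λ t = c₂₂ᵗ + c₂ᵢᵗ + cᵢ₂ᵗ + cᵢᵢᵗ
-- common neighbours.  In a DDG with λ₁ ≠ λ₂ each colour lies entirely inside or entirely across
-- the canonical partition, and the colours inside are closed under positive intersection
-- numbers.  Since c_{jj}^2, c_{j2}^{7-j} and c_{22}^1 are positive for j ∈ {3,4}, this leaves
-- Λ3 = Λ4 together with Λ1 = Λ2 (classes of e1) or Λ2 = Λ3 (classes of e0); conversely these
-- equalities make e1, resp. e0, a canonical partition.  Triviality of rad(s3) and rad(s4) makes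
-- the number of paths x → z → y with z in the e-class of x and (z, y) ∈ s_j the same for
-- (x, y) ∈ s3 and s4 (e = e0, e1); double counting then expresses Λ in valencies and turns the
-- three equalities into c₃₃³ = c₃₃⁴, (A) and, given Λ3 = Λ4, (B).  Finally λ₁ = λ₂ is forced
-- exactly when all Λ t agree, that is, when (A) and (B) both hold.

open import Defs
open import Data.Nat using (ℕ)
open import Data.Fin using (Fin)
open import Data.Bool using (T)
open import Data.Product using (_×_)
open import Data.Sum using (_⊎_)
open import Relation.Nullary using (¬_)
open import Relation.Binary.PropositionalEquality using (_≡_)
open import Function.Bundles using (_⇔_)

open import Data.Nat as ℕ using (zero; suc; _+_; _*_; _<_; z≤n; s≤s)
open import Data.Nat.Base using (>-nonZero)
open import Data.Nat.Properties
  using ( +-*-semiring; *-commutativeSemigroup; +-identityʳ; +-assoc; +-comm; +-cancelˡ-≡; +-cancelʳ-≡; +-monoʳ-<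
        ; *-identityʳ; *-zeroʳ; *-comm; *-distribˡ-+; *-distribʳ-+; *-cancelˡ-≡; *-mono-≤
        ; ≤-pred; ≤-trans; m≤m+n; n≤0⇒n≡0; ≮⇒≥; n≮0 )
open import Data.Nat.Tactic.RingSolver using (solve-∀; solve)
open import Algebra.Properties.CommutativeSemigroup *-commutativeSemigroup using (x∙yz≈y∙xz; x∙yz≈y∙zx)
open import Data.Bool using (Bool; true; false; if_then_else_; _∧_; _∨_)
open import Data.Bool.Properties using (T-∧; ∧-zeroʳ; ∧-comm)
open import Data.Fin using (zero; suc; _≟_; toℕ; fromℕ<)
open import Data.Fin.Properties using (suc-injective; toℕ-injective; toℕ-fromℕ<; toℕ<n)
open import Data.Product using (Σ; ∃-syntax; _,_; proj₁; proj₂)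
open import Data.Sum as Sum using (inj₁; inj₂)
open import Data.Empty using (⊥; ⊥-elim)
open import Data.Unit using (tt)
open import Data.Maybe as Maybe using (Maybe; just; nothing; fromMaybe)
open import Data.List using (_∷_; [])
open import Function using (_∘_; case_of_)
open import Function.Bundles using (Equivalence; mk⇔)
open import Function.Properties.Equivalence using (⇔-setoid)
  renaming (refl to ⇔-refl; sym to ⇔-sym; trans to ⇔-trans)
open import Level using (0ℓ)
open import Relation.Nullary using (yes; no)
open import Relation.Nullary.Decidable using (dec-true; dec-false)
open import Relation.Nullary.Reflects using (det; T-reflects; fromEquivalence)
open import Relation.Binary.PropositionalEquality
  using (_≢_; refl; sym; trans; cong; cong₂; subst; module ≡-Reasoning)
import Relation.Binary.Reasoning.Setoid as SetoidReasoning
open import Algebra.Bundles using (AbelianGroup)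
open import Algebra.Properties.Semiring.Sum +-*-semiring
  using (sum-syntax; ∑-comm; ∑-distrib-+; *-distribˡ-sum; *-distribʳ-sum; sum-replicate-zero)
  renaming (sum to ∑; sum-cong-≗ to ∑-cong)
import Data.Integer as ℤ
import Data.Integer.Properties as ℤP
import Data.Integer.Tactic.RingSolver as ℤ-Solver
open import Algebra.Properties.Group (AbelianGroup.group ℤP.+-0-abelianGroup) using (∙-cancelʳ)
open import Data.Rational using (ℚ; toℚᵘ) renaming (_+_ to _+ℚ_; _-_ to _-ℚ_)
open import Data.Rational.Properties
  using (toℚᵘ-injective; toℚᵘ-cong; toℚᵘ-fromℚᵘ; toℚᵘ-homo-+; toℚᵘ-homo‿-)
open import Data.Rational.Unnormalised as ℚᵘ using (ℚᵘ; mkℚᵘ; *≡*; ↥_; ↧_; _≃_)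
open import Data.Rational.Unnormalised.Properties using (≃-sym; ≃-trans; +-cong; -‿cong)

open Equivalence using (to; from)

𝟙 : Bool → ℕ
𝟙 b = if b then 1 else 0

𝟙-∧ : ∀ a b → 𝟙 (a ∧ b) ≡ 𝟙 a * 𝟙 b
𝟙-∧ false b = refl
𝟙-∧ true  b = sym (+-identityʳ (𝟙 b))

𝟙-∨ : ∀ a b → ¬ (T a × T b) → 𝟙 (a ∨ b) ≡ 𝟙 a + 𝟙 b
𝟙-∨ true  true  a∧b = ⊥-elim (a∧b (tt , tt))
𝟙-∨ true  false _   = refl
𝟙-∨ false b     _   = refl

𝟙-∨∧∨ : ∀ a b c d → ¬ (T a × T b) → ¬ (T c × T d) →
  𝟙 ((a ∨ b) ∧ (c ∨ d)) ≡ 𝟙 (a ∧ c) + 𝟙 (a ∧ d) + 𝟙 (b ∧ c) + 𝟙 (b ∧ d)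
𝟙-∨∧∨ true  true  _     _     a∧b _   = ⊥-elim (a∧b (tt , tt))
𝟙-∨∧∨ _     _     true  true  _   c∧d = ⊥-elim (c∧d (tt , tt))
𝟙-∨∧∨ false false _     _     _   _   = refl
𝟙-∨∧∨ true  false true  false _   _   = refl
𝟙-∨∧∨ true  false false true  _   _   = refl
𝟙-∨∧∨ true  false false false _   _   = refl
𝟙-∨∧∨ false true  true  false _   _   = refl
𝟙-∨∧∨ false true  false true  _   _   = refl
𝟙-∨∧∨ false true  false false _   _   = refl

==⇒≡ : ∀ {n} {a b : Fin n} → T (a == b) → a ≡ b
==⇒≡ {a = a} {b} t with a ≟ b
... | yes a≡b = a≡b

≡⇒== : ∀ {n} {a b : Fin n} → a ≡ b → T (a == b)
≡⇒== {a = a} {b} a≡b with a ≟ b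
... | yes _  = tt
... | no a≢b = a≢b a≡b

==-disjoint : ∀ {n} {r s : Fin n} → r ≢ s → ∀ c → ¬ (T (c == r) × T (c == s))
==-disjoint r≢s c (c≡r , c≡s) = r≢s (trans (sym (==⇒≡ {a = c} c≡r)) (==⇒≡ {a = c} c≡s))

T-ext : ∀ {a b} → (T a → T b) → (T b → T a) → a ≡ b
T-ext {a} a⇒b b⇒a = det (T-reflects a) (fromEquivalence b⇒a a⇒b)

∑-select : ∀ {n} (a : Fin n) (f : Fin n → ℕ) → ∑[ u < n ] (𝟙 (a == u) * f u) ≡ f a
∑-select {suc n} zero    f =
  trans (cong₂ _+_ (+-identityʳ (f zero)) (sum-replicate-zero n)) (+-identityʳ (f zero))
∑-select {suc n} (suc a) f = ∑-select a (f ∘ suc)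

∑-select-∧ : ∀ {n} (a : Fin n) (b : Bool) → ∑[ u < n ] 𝟙 ((a == u) ∧ b) ≡ 𝟙 b
∑-select-∧ a b = trans (∑-cong (λ u → 𝟙-∧ (a == u) b)) (∑-select a (λ _ → 𝟙 b))

∑-restrict-cong : ∀ {n} (p : Fin n → Bool) {f g : Fin n → ℕ} → (∀ u → T (p u) → f u ≡ g u) →
  ∑[ u < n ] (𝟙 (p u) * f u) ≡ ∑[ u < n ] (𝟙 (p u) * g u)
∑-restrict-cong p {f} {g} eq = ∑-cong restrict
  where
  restrict : ∀ u → 𝟙 (p u) * f u ≡ 𝟙 (p u) * g u
  restrict u with p u | eq u
  ... | true  | f≡g = cong (_+ 0) (f≡g tt)
  ... | false | _   = refl

∑-scale : ∀ {n} a (w f : Fin n → ℕ) → ∑[ u < n ] (w u * (a * f u)) ≡ a * ∑[ u < n ] (w u * f u)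
∑-scale a w f = trans (∑-cong (λ u → x∙yz≈y∙xz (w u) a (f u))) (sym (*-distribˡ-sum a (λ u → w u * f u)))

∑-linear : ∀ {n} a b (w f g : Fin n → ℕ) →
  ∑[ u < n ] (w u * (a * f u + b * g u)) ≡ a * ∑[ u < n ] (w u * f u) + b * ∑[ u < n ] (w u * g u)
∑-linear a b w f g = begin
  ∑ (λ u → w u * (a * f u + b * g u))           ≡⟨ ∑-cong (λ u → *-distribˡ-+ (w u) (a * f u) (b * g u)) ⟩
  ∑ (λ u → w u * (a * f u) + w u * (b * g u))   ≡⟨ ∑-distrib-+ (λ u → w u * (a * f u)) (λ u → w u * (b * g u)) ⟩
  ∑ (λ u → w u * (a * f u)) + ∑ (λ u → w u * (b * g u))
                                                ≡⟨ cong₂ _+_ (∑-scale a w f) (∑-scale b w g) ⟩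
  a * ∑ (λ u → w u * f u) + b * ∑ (λ u → w u * g u) ∎
  where open ≡-Reasoning

count≡∑ : ∀ {n} (p : Fin n → Bool) → count p ≡ ∑[ x < n ] 𝟙 (p x)
count≡∑ {zero}  p = refl
count≡∑ {suc n} p = cong (𝟙 (p zero) +_) (count≡∑ (p ∘ suc))

count-cong : ∀ {n} {p q : Fin n → Bool} → (∀ x → p x ≡ q x) → count p ≡ count q
count-cong {zero}  eq = refl
count-cong {suc n} eq = cong₂ _+_ (cong 𝟙 (eq zero)) (count-cong (eq ∘ suc))

count-∨ : ∀ {n} (p q : Fin n → Bool) → (∀ x → ¬ (T (p x) × T (q x))) →
  count (λ x → p x ∨ q x) ≡ count p + count q
count-∨ p q disjoint = begin
  count (λ x → p x ∨ q x)            ≡⟨ count≡∑ (λ x → p x ∨ q x) ⟩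
  ∑ (λ x → 𝟙 (p x ∨ q x))            ≡⟨ ∑-cong (λ x → 𝟙-∨ (p x) (q x) (disjoint x)) ⟩
  ∑ (λ x → 𝟙 (p x) + 𝟙 (q x))        ≡⟨ ∑-distrib-+ (𝟙 ∘ p) (𝟙 ∘ q) ⟩
  ∑ (𝟙 ∘ p) + ∑ (𝟙 ∘ q)              ≡⟨ cong₂ _+_ (count≡∑ p) (count≡∑ q) ⟨
  count p + count q                  ∎
  where open ≡-Reasoning

count≡0 : ∀ {n} (p : Fin n → Bool) → (∀ x → ¬ T (p x)) → count p ≡ 0
count≡0 {zero}  p none = refl
count≡0 {suc n} p none with p zero in eq
... | true  = ⊥-elim (none zero (subst T (sym eq) tt))
... | false = count≡0 (p ∘ suc) (none ∘ suc)

count>0⇒∃ : ∀ {n} (p : Fin n → Bool) → 0 < count p → ∃[ x ] T (p x)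
count>0⇒∃ {suc n} p pos with p zero in eq
... | true  = zero , subst T (sym eq) tt
... | false = let x , px = count>0⇒∃ (p ∘ suc) pos in suc x , px

∃⇒count>0 : ∀ {n} (p : Fin n → Bool) {x} → T (p x) → 0 < count p
∃⇒count>0 {suc n} p {zero}  px with p zero
... | true = s≤s z≤n
∃⇒count>0 {suc n} p {suc x} px with p zero
... | true  = s≤s z≤n
... | false = ∃⇒count>0 (p ∘ suc) px

count>1⇒another : ∀ {n} (p : Fin n → Bool) {x} → T (p x) → 1 < count p →
  ∃[ y ] y ≢ x × T (p y)
count>1⇒another {suc n} p {zero} px many with p zero
... | true = let y , py = count>0⇒∃ (p ∘ suc) (≤-pred many) in suc y , (λ ()) , py
count>1⇒another {suc n} p {suc x} px many with p zero in eq
... | true  = zero , (λ ()) , subst T (sym eq) tt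
... | false = let y , y≢x , py = count>1⇒another (p ∘ suc) px many in
              suc y , y≢x ∘ suc-injective , py

count-∧-== : ∀ {n} (q : Fin n → Bool) y → count (λ z → q z ∧ (z == y)) ≡ 𝟙 (q y)
count-∧-== {suc n} q zero with q zero
... | true  = cong suc (count≡0 _ λ z → subst T (∧-zeroʳ (q (suc z))))
... | false = count≡0 _ λ z → subst T (∧-zeroʳ (q (suc z)))
count-∧-== {suc n} q (suc y) = cong₂ _+_ (cong 𝟙 (∧-zeroʳ (q zero))) (count-∧-== (q ∘ suc) y)

-- Indexing the classes of an equivalence relation on Fin v

rank : ∀ {n} → (Fin n → Bool) → Fin n → ℕ
rank q zero    = 0
rank q (suc y) = 𝟙 (q zero) + rank (q ∘ suc) y

rank<count : ∀ {n} (q : Fin n → Bool) {y} → T (q y) → rank q y < count q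
rank<count q {zero} qy with q zero
... | true = s≤s z≤n
rank<count q {suc y} qy = +-monoʳ-< (𝟙 (q zero)) (rank<count (q ∘ suc) qy)

rank-injective : ∀ {n} (q : Fin n → Bool) {y₁ y₂} → T (q y₁) → T (q y₂) →
  rank q y₁ ≡ rank q y₂ → y₁ ≡ y₂
rank-injective q {zero}   {zero}   _   _   _  = refl
rank-injective q {zero}   {suc y₂} qy₁ _   eq with q zero
... | true = case eq of λ ()
rank-injective q {suc y₁} {zero}   _   qy₂ eq with q zero
... | true = case eq of λ ()
rank-injective q {suc y₁} {suc y₂} qy₁ qy₂ eq =
  cong suc (rank-injective (q ∘ suc) qy₁ qy₂ (+-cancelˡ-≡ (𝟙 (q zero)) _ _ eq))

rank-surjective : ∀ {n} (q : Fin n → Bool) {j} → j < count q → ∃[ y ] T (q y) × rank q y ≡ j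
rank-surjective {suc n} q {j} j<count with q zero in q₀
rank-surjective {suc n} q {zero}  _            | true = zero , subst T (sym q₀) tt , refl
rank-surjective {suc n} q {suc j} (s≤s j<count) | true
  with y , qy , rank≡j ← rank-surjective (q ∘ suc) j<count =
  suc y , qy , trans (cong (λ b → 𝟙 b + rank (q ∘ suc) y) q₀) (cong suc rank≡j)
rank-surjective {suc n} q {j} j<count | false
  with y , qy , rank≡j ← rank-surjective (q ∘ suc) j<count =
  suc y , qy , trans (cong (λ b → 𝟙 b + rank (q ∘ suc) y) q₀) rank≡j

find : ∀ {n} → (Fin n → Bool) → Maybe (Fin n)
find {zero}  p = nothing
find {suc n} p = if p zero then just zero else Maybe.map suc (find (p ∘ suc))

find-cong : ∀ {n} {p q : Fin n → Bool} → (∀ x → p x ≡ q x) → find p ≡ find q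
find-cong {zero}          eq = refl
find-cong {suc n} {p} {q} eq rewrite eq zero | find-cong {p = p ∘ suc} {q ∘ suc} (eq ∘ suc) = refl

find-just : ∀ {n} (p : Fin n → Bool) {x} → T (p x) → ∃[ y ] find p ≡ just y × T (p y)
find-just {suc n} p {x} px with p zero in p₀
... | true = zero , refl , subst T (sym p₀) tt
find-just {suc n} p {zero}  px | false = ⊥-elim (subst T p₀ px)
find-just {suc n} p {suc x} px | false
  with y , found , py ← find-just (p ∘ suc) px = suc y , cong (Maybe.map suc) found , py

-- A class is indexed by the rank of its least element among all least elements.
module EquivalenceClasses {v : ℕ} (R : Fin v → Fin v → Bool)
  (R-refl : ∀ x → T (R x x)) (R-sym : ∀ {x y} → T (R x y) → T (R y x))
  (R-trans : ∀ {x y z} → T (R x y) → T (R y z) → T (R x z)) where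

  rep : Fin v → Fin v
  rep x = fromMaybe x (find (R x))

  rep-related : ∀ x → T (R x (rep x))
  rep-related x with y , found , Rxy ← find-just (R x) (R-refl x) rewrite found = Rxy

  rep-cong : ∀ {x y} → T (R x y) → rep x ≡ rep y
  rep-cong {x} {y} Rxy with z , found , _ ← find-just (R x) (R-refl x) =
    trans (cong (fromMaybe x) found) (cong (fromMaybe y) (trans (sym found) (find-cong same-class)))
    where
    same-class : ∀ w → R x w ≡ R y w
    same-class w = T-ext (R-trans (R-sym Rxy)) (R-trans Rxy)

  IsRep : Fin v → Bool
  IsRep y = rep y == y

  rep-IsRep : ∀ x → T (IsRep (rep x))
  rep-IsRep x = ≡⇒== (sym (rep-cong (rep-related x)))

  classes : ℕ
  classes = count IsRep

  index : Fin v → Fin classes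
  index x = fromℕ< (rank<count IsRep (rep-IsRep x))

  toℕ-index : ∀ x → toℕ (index x) ≡ rank IsRep (rep x)
  toℕ-index x = toℕ-fromℕ< (rank<count IsRep (rep-IsRep x))

  index⇔R : ∀ x y → (index x ≡ index y) ⇔ T (R x y)
  index⇔R x y = mk⇔ same-index⇒R (λ Rxy → toℕ-injective (index-cong Rxy))
    where
    index-cong : ∀ {x y} → T (R x y) → toℕ (index x) ≡ toℕ (index y)
    index-cong {x} {y} Rxy =
      trans (toℕ-index x) (trans (cong (rank IsRep) (rep-cong Rxy)) (sym (toℕ-index y)))
    same-index⇒R : index x ≡ index y → T (R x y)
    same-index⇒R eq =
      R-trans (rep-related x) (subst (λ r → T (R r y)) (sym same-rep) (R-sym (rep-related y)))
      where
      same-rep : rep x ≡ rep y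
      same-rep = rank-injective IsRep (rep-IsRep x) (rep-IsRep y)
        (trans (sym (toℕ-index x)) (trans (cong toℕ eq) (toℕ-index y)))

  index-size : ∀ {n} → (∀ x → count (R x) ≡ n) → ∀ j → count (λ x → index x == j) ≡ n
  index-size {n} size j with y , y-rep , rank≡j ← rank-surjective IsRep (toℕ<n j) = begin
    count (λ x → index x == j)
      ≡⟨ count-cong (λ x → T-ext (R-sym ∘ to (index⇔R x y) ∘ at-j) (from-j ∘ from (index⇔R x y) ∘ R-sym)) ⟩
    count (R y)
      ≡⟨ size y ⟩
    n
      ∎
    where
    open ≡-Reasoning
    index-y : index y ≡ j
    index-y = toℕ-injective
      (trans (toℕ-index y) (trans (cong (rank IsRep) (==⇒≡ {a = rep y} y-rep)) rank≡j))
    at-j : ∀ {x} → T (index x == j) → index x ≡ index y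
    at-j x-at-j = trans (==⇒≡ x-at-j) (sym index-y)
    from-j : ∀ {x} → index x ≡ index y → T (index x == j)
    from-j eq = ≡⇒== (trans eq index-y)

module ⇔-Reasoning = SetoidReasoning (⇔-setoid 0ℓ)

+-cancelˡ-⇔ : ∀ k {x y} → (x ≡ y) ⇔ (k + x ≡ k + y)
+-cancelˡ-⇔ k = mk⇔ (cong (k +_)) (+-cancelˡ-≡ k _ _)

+-cancelʳ-⇔ : ∀ k {x y} → (x ≡ y) ⇔ (x + k ≡ y + k)
+-cancelʳ-⇔ k = mk⇔ (cong (_+ k)) (+-cancelʳ-≡ k _ _)

*-cancelˡ-⇔ : ∀ {m} → 0 < m → ∀ {x y} → (x ≡ y) ⇔ (m * x ≡ m * y)
*-cancelˡ-⇔ {m} m>0 = mk⇔ (cong (m *_)) (*-cancelˡ-≡ _ _ m {{>-nonZero m>0}})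

≡-subst-⇔ : ∀ {a a′ b b′ : ℕ} → a ≡ a′ → b ≡ b′ → (a ≡ b) ⇔ (a′ ≡ b′)
≡-subst-⇔ refl refl = ⇔-refl

shift-⇔ : ∀ {a b k K x y} → a + k ≡ K + x → b + k ≡ K + y → (a ≡ b) ⇔ (x ≡ y)
shift-⇔ {a} {b} {k} {K} {x} {y} ak bk = mk⇔
  (λ a≡b → +-cancelˡ-≡ K x y (trans (sym ak) (trans (cong (_+ k) a≡b) bk)))
  (λ x≡y → +-cancelʳ-≡ k a b (trans ak (trans (cong (K +_) x≡y) (sym bk))))

balanced-⇔ : ∀ {a b x y} → a + y ≡ b + x → (a ≡ b) ⇔ (x ≡ y)
balanced-⇔ {a} {b} {x} {y} ay≡bx = mk⇔
  (λ { refl → sym (+-cancelˡ-≡ a y x ay≡bx) })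
  (λ { refl → +-cancelʳ-≡ y a b ay≡bx })

exchange : ∀ {a b u w x y} → u + a ≡ w + b → x + u ≡ y + w → a + y ≡ b + x
exchange {a} {b} {u} {w} {x} {y} e₁ e₂ = +-cancelʳ-≡ (u + w) _ _ (begin
  a + y + (u + w)   ≡⟨ solve (a ∷ y ∷ u ∷ w ∷ []) ⟩
  (u + a) + (y + w) ≡⟨ cong₂ _+_ e₁ (sym e₂) ⟩
  (w + b) + (x + u) ≡⟨ solve (w ∷ b ∷ x ∷ u ∷ []) ⟩
  b + x + (u + w)   ∎)
  where open ≡-Reasoning

*>0⇒>0ʳ : ∀ m {n} → 0 < m * n → 0 < n
*>0⇒>0ʳ m {zero}  m*0>0 = ⊥-elim (n≮0 (subst (0 <_) (*-zeroʳ m) m*0>0))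
*>0⇒>0ʳ m {suc n} _     = s≤s z≤n

module IntersectionArithmetic (ni nj n1 n2 β α : ℕ)
  (N*β : (ni + nj) * β ≡ ni * (1 + n1)) (N*α : (ni + nj) * α ≡ ni * (1 + n1 + n2)) where

  N*c₂ : ∀ {c₁ c₂} → 0 < n2 → ni + n1 * c₁ ≡ ni * β → ni + n1 * c₁ + n2 * c₂ ≡ ni * α →
    (ni + nj) * c₂ ≡ ni * ni
  N*c₂ {c₁} {c₂} n2>0 e0 e1 = *-cancelˡ-≡ _ _ n2 {{>-nonZero n2>0}} (+-cancelʳ-≡ (ni * (ni * (1 + n1))) _ _ (begin
    n2 * ((ni + nj) * c₂) + ni * (ni * (1 + n1))   ≡⟨ cong (λ e → n2 * ((ni + nj) * c₂) + ni * e) N*β ⟨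
    n2 * ((ni + nj) * c₂) + ni * ((ni + nj) * β)   ≡⟨ solve (n2 ∷ ni ∷ nj ∷ c₂ ∷ β ∷ []) ⟩
    (ni + nj) * (ni * β + n2 * c₂)                 ≡⟨ cong (λ e → (ni + nj) * (e + n2 * c₂)) e0 ⟨
    (ni + nj) * (ni + n1 * c₁ + n2 * c₂)           ≡⟨ cong ((ni + nj) *_) e1 ⟩
    (ni + nj) * (ni * α)                           ≡⟨ solve (ni ∷ nj ∷ α ∷ []) ⟩
    ni * ((ni + nj) * α)                           ≡⟨ cong (ni *_) N*α ⟩
    ni * (ni * (1 + n1 + n2))                      ≡⟨ solve (ni ∷ n1 ∷ n2 ∷ []) ⟩
    n2 * (ni * ni) + ni * (ni * (1 + n1))          ∎))
    where open ≡-Reasoning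

  condA-arith : ∀ {c₁ c₂} → 0 < ni + nj → 0 < n1 → ni + n1 * c₁ ≡ ni * β → (ni + nj) * c₂ ≡ ni * ni →
    (c₁ + (1 + n1) ≡ c₂) ⇔ ((ni + nj) * (n1 * (n1 + 1)) ≡ ni * nj)
  condA-arith {c₁} {c₂} N>0 n1>0 e0 N*c₂ = let open ⇔-Reasoning in begin
    (c₁ + (1 + n1) ≡ c₂)                                        ≈⟨ *-cancelˡ-⇔ (*-mono-≤ N>0 n1>0) ⟩
    ((ni + nj) * n1 * (c₁ + (1 + n1)) ≡ (ni + nj) * n1 * c₂)    ≈⟨ shift-⇔ lhs rhs ⟩
    ((ni + nj) * (n1 * (n1 + 1)) ≡ ni * nj)                     ∎
    where
    lhs : (ni + nj) * n1 * (c₁ + (1 + n1)) + (ni + nj) * ni ≡ ni * (ni * (1 + n1)) + (ni + nj) * (n1 * (n1 + 1))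
    lhs = begin
      (ni + nj) * n1 * (c₁ + (1 + n1)) + (ni + nj) * ni
        ≡⟨ solve (ni ∷ nj ∷ n1 ∷ c₁ ∷ []) ⟩
      (ni + nj) * (ni + n1 * c₁) + (ni + nj) * (n1 * (n1 + 1))
        ≡⟨ cong (λ e → (ni + nj) * e + (ni + nj) * (n1 * (n1 + 1))) e0 ⟩
      (ni + nj) * (ni * β) + (ni + nj) * (n1 * (n1 + 1))
        ≡⟨ solve (ni ∷ nj ∷ n1 ∷ β ∷ []) ⟩
      ni * ((ni + nj) * β) + (ni + nj) * (n1 * (n1 + 1))
        ≡⟨ cong (λ e → ni * e + (ni + nj) * (n1 * (n1 + 1))) N*β ⟩
      ni * (ni * (1 + n1)) + (ni + nj) * (n1 * (n1 + 1))
        ∎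
      where open ≡-Reasoning
    rhs : (ni + nj) * n1 * c₂ + (ni + nj) * ni ≡ ni * (ni * (1 + n1)) + ni * nj
    rhs = begin
      (ni + nj) * n1 * c₂ + (ni + nj) * ni   ≡⟨ solve (ni ∷ nj ∷ n1 ∷ c₂ ∷ []) ⟩
      n1 * ((ni + nj) * c₂) + (ni + nj) * ni ≡⟨ cong (λ e → n1 * e + (ni + nj) * ni) N*c₂ ⟩
      n1 * (ni * ni) + (ni + nj) * ni        ≡⟨ solve (ni ∷ nj ∷ n1 ∷ []) ⟩
      ni * (ni * (1 + n1)) + ni * nj         ∎
      where open ≡-Reasoning

  condB-arith : ∀ {c c₂ d} → 0 < ni + nj → 0 < nj →
    (ni + nj) * c₂ ≡ ni * ni → (ni + nj) * d ≡ ni * n2 → (ni + nj) * c + ni * α ≡ ni * ni →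
    (n2 + c₂ ≡ 2 * d + c + (1 + n1)) ⇔ (n2 * nj ≡ (n1 + 1) * nj + 2 * ni * (n1 + 1))
  condB-arith {c} {c₂} {d} N>0 nj>0 N*c₂ N*d N*c+ni*α = let open ⇔-Reasoning in begin
    (n2 + c₂ ≡ 2 * d + c + (1 + n1))
      ≈⟨ *-cancelˡ-⇔ (*-mono-≤ N>0 N>0) ⟩
    ((ni + nj) * (ni + nj) * (n2 + c₂) ≡ (ni + nj) * (ni + nj) * (2 * d + c + (1 + n1)))
      ≈⟨ shift-⇔ lhs rhs ⟩
    (nj * (n2 * nj) ≡ nj * ((n1 + 1) * nj + 2 * ni * (n1 + 1)))
      ≈⟨ *-cancelˡ-⇔ nj>0 ⟨
    (n2 * nj ≡ (n1 + 1) * nj + 2 * ni * (n1 + 1))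
      ∎
    where
    -- With N = ni + nj, both sides plus ni²(1 + n1 + n2) are K + nj·(…) for
    -- K = (N² − nj²)·n2 + N·ni² + ni²(1 + n1 + n2), written below without subtraction.
    lhs : (ni + nj) * (ni + nj) * (n2 + c₂) + ni * (ni * (1 + n1 + n2))
        ≡ (ni * ni + 2 * ni * nj) * n2 + (ni + nj) * (ni * ni) + ni * (ni * (1 + n1 + n2)) + nj * (n2 * nj)
    lhs = begin
      (ni + nj) * (ni + nj) * (n2 + c₂) + ni * (ni * (1 + n1 + n2)) ≡⟨ solve (ni ∷ nj ∷ n1 ∷ n2 ∷ c₂ ∷ []) ⟩
      (ni + nj) * ((ni + nj) * c₂) + (ni + nj) * (ni + nj) * n2 + ni * (ni * (1 + n1 + n2))
        ≡⟨ cong (λ e → (ni + nj) * e + (ni + nj) * (ni + nj) * n2 + ni * (ni * (1 + n1 + n2))) N*c₂ ⟩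
      (ni + nj) * (ni * ni) + (ni + nj) * (ni + nj) * n2 + ni * (ni * (1 + n1 + n2))
        ≡⟨ solve (ni ∷ nj ∷ n1 ∷ n2 ∷ []) ⟩
      (ni * ni + 2 * ni * nj) * n2 + (ni + nj) * (ni * ni) + ni * (ni * (1 + n1 + n2)) + nj * (n2 * nj)
        ∎
      where open ≡-Reasoning
    rhs : (ni + nj) * (ni + nj) * (2 * d + c + (1 + n1)) + ni * (ni * (1 + n1 + n2))
        ≡ (ni * ni + 2 * ni * nj) * n2 + (ni + nj) * (ni * ni) + ni * (ni * (1 + n1 + n2))
          + nj * ((n1 + 1) * nj + 2 * ni * (n1 + 1))
    rhs = begin
      (ni + nj) * (ni + nj) * (2 * d + c + (1 + n1)) + ni * (ni * (1 + n1 + n2))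
        ≡⟨ cong (λ e → (ni + nj) * (ni + nj) * (2 * d + c + (1 + n1)) + ni * e) N*α ⟨
      (ni + nj) * (ni + nj) * (2 * d + c + (1 + n1)) + ni * ((ni + nj) * α)
        ≡⟨ solve (ni ∷ nj ∷ n1 ∷ d ∷ c ∷ α ∷ []) ⟩
      2 * (ni + nj) * ((ni + nj) * d) + (ni + nj) * ((ni + nj) * c + ni * α) + (ni + nj) * (ni + nj) * (1 + n1)
        ≡⟨ cong₂ (λ e e′ → 2 * (ni + nj) * e + (ni + nj) * e′ + (ni + nj) * (ni + nj) * (1 + n1)) N*d N*c+ni*α ⟩
      2 * (ni + nj) * (ni * n2) + (ni + nj) * (ni * ni) + (ni + nj) * (ni + nj) * (1 + n1)
        ≡⟨ solve (ni ∷ nj ∷ n1 ∷ n2 ∷ []) ⟩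
      (ni * ni + 2 * ni * nj) * n2 + (ni + nj) * (ni * ni) + ni * (ni * (1 + n1 + n2))
        + nj * ((n1 + 1) * nj + 2 * ni * (n1 + 1))
        ∎
      where open ≡-Reasoning

-- The conditions (A) and (B) over ℚ

module Fractions where
  open ℤ using (+_)

  ≡⇔≃ : ∀ {p q : ℚ} {P Q : ℚᵘ} → toℚᵘ p ≃ P → toℚᵘ q ≃ Q → (p ≡ q) ⇔ (P ≃ Q)
  ≡⇔≃ p≃P q≃Q = mk⇔ (λ p≡q → ≃-trans (≃-sym p≃P) (≃-trans (toℚᵘ-cong p≡q) q≃Q))
                     (λ P≃Q → toℚᵘ-injective (≃-trans p≃P (≃-trans P≃Q (≃-sym q≃Q))))

  toℚᵘ-frac : ∀ a b → toℚᵘ (frac a (suc b)) ≃ mkℚᵘ (+ a) b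
  toℚᵘ-frac a b = toℚᵘ-fromℚᵘ (mkℚᵘ (+ a) b)

  toℚᵘ-+ : ∀ {p q P Q} → toℚᵘ p ≃ P → toℚᵘ q ≃ Q → toℚᵘ (p +ℚ q) ≃ P ℚᵘ.+ Q
  toℚᵘ-+ {p} {q} p≃P q≃Q = ≃-trans (toℚᵘ-homo-+ p q) (+-cong p≃P q≃Q)

  toℚᵘ-- : ∀ {p q P Q} → toℚᵘ p ≃ P → toℚᵘ q ≃ Q → toℚᵘ (p -ℚ q) ≃ P ℚᵘ.- Q
  toℚᵘ-- {p} {q} p≃P q≃Q = toℚᵘ-+ p≃P (≃-trans (toℚᵘ-homo‿- q) (-‿cong q≃Q))

  -- c carries the negative part of a cross-multiplied numerator to the other side.
  ≃⇔≡ : ∀ {P Q a b} c → ↥ P ℤ.* ↧ Q ℤ.+ c ≡ + a → ↥ Q ℤ.* ↧ P ℤ.+ c ≡ + b → (P ≃ Q) ⇔ (a ≡ b)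
  ≃⇔≡ c left right = mk⇔
    (λ { (*≡* cross) → ℤP.+-injective (trans (sym left) (trans (cong (ℤ._+ c) cross) right)) })
    (λ a≡b → *≡* (∙-cancelʳ c _ _ (trans left (trans (cong +_ a≡b) (sym right)))))

  condA⇔ : ∀ {n1 n3 n4} → 0 < n1 → 0 < n3 → 0 < n4 →
    (frac 1 n3 +ℚ frac 1 n4 ≡ frac 1 n1 -ℚ frac 1 (n1 + 1)) ⇔ ((n3 + n4) * (n1 * (n1 + 1)) ≡ n3 * n4)
  condA⇔ {suc m1} {suc m3} {suc m4} _ _ _ = ⇔-trans
    (≡⇔≃ (toℚᵘ-+ (toℚᵘ-frac 1 m3) (toℚᵘ-frac 1 m4)) (toℚᵘ-- (toℚᵘ-frac 1 m1) (toℚᵘ-frac 1 (m1 + 1))))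
    (≃⇔≡ (+ 0) left right)
    where
    n1 n3 n4 : ℕ
    n1 = suc m1
    n3 = suc m3
    n4 = suc m4
    left : (+ 1 ℤ.* + n4 ℤ.+ + 1 ℤ.* + n3) ℤ.* + (n1 * (n1 + 1)) ℤ.+ + 0 ≡ + ((n3 + n4) * (n1 * (n1 + 1)))
    left = begin
      (+ 1 ℤ.* + n4 ℤ.+ + 1 ℤ.* + n3) ℤ.* + (n1 * (n1 + 1)) ℤ.+ + 0 ≡⟨ ring (+ n3) (+ n4) (+ (n1 * (n1 + 1))) ⟩
      (+ n3 ℤ.+ + n4) ℤ.* + (n1 * (n1 + 1))                       ≡⟨ cong (ℤ._* + (n1 * (n1 + 1))) (ℤP.pos-+ n3 n4) ⟨
      + (n3 + n4) ℤ.* + (n1 * (n1 + 1))                           ≡⟨ ℤP.pos-* (n3 + n4) (n1 * (n1 + 1)) ⟨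
      + ((n3 + n4) * (n1 * (n1 + 1)))                             ∎
      where
      open ≡-Reasoning
      ring : ∀ a b k → (+ 1 ℤ.* b ℤ.+ + 1 ℤ.* a) ℤ.* k ℤ.+ + 0 ≡ (a ℤ.+ b) ℤ.* k
      ring = ℤ-Solver.solve-∀
    right : (+ 1 ℤ.* + (n1 + 1) ℤ.+ ℤ.- (+ 1) ℤ.* + n1) ℤ.* + (n3 * n4) ℤ.+ + 0 ≡ + (n3 * n4)
    right = begin
      (+ 1 ℤ.* + (n1 + 1) ℤ.+ ℤ.- (+ 1) ℤ.* + n1) ℤ.* + (n3 * n4) ℤ.+ + 0
        ≡⟨ cong (λ e → (+ 1 ℤ.* e ℤ.+ ℤ.- (+ 1) ℤ.* + n1) ℤ.* + (n3 * n4) ℤ.+ + 0) (ℤP.pos-+ n1 1) ⟩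
      (+ 1 ℤ.* (+ n1 ℤ.+ + 1) ℤ.+ ℤ.- (+ 1) ℤ.* + n1) ℤ.* + (n3 * n4) ℤ.+ + 0
        ≡⟨ ring (+ n1) (+ (n3 * n4)) ⟩
      + (n3 * n4)
        ∎
      where
      open ≡-Reasoning
      ring : ∀ a k → (+ 1 ℤ.* (a ℤ.+ + 1) ℤ.+ ℤ.- (+ 1) ℤ.* a) ℤ.* k ℤ.+ + 0 ≡ k
      ring = ℤ-Solver.solve-∀

  condB⇔ : ∀ {n1 n2 ni nj} → 0 < nj →
    (frac n2 (n1 + 1) -ℚ frac (2 * ni) nj ≡ frac 1 1) ⇔ (n2 * nj ≡ (n1 + 1) * nj + 2 * ni * (n1 + 1))
  condB⇔ {n1} {n2} {ni} {suc mj} _ rewrite +-comm n1 1 = ⇔-trans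
    (≡⇔≃ (toℚᵘ-- (toℚᵘ-frac n2 n1) (toℚᵘ-frac (2 * ni) mj)) (toℚᵘ-frac 1 0))
    (≃⇔≡ (+ (2 * ni) ℤ.* + suc n1) left right)
    where
    nj : ℕ
    nj = suc mj
    left : (+ n2 ℤ.* + nj ℤ.+ ℤ.- + (2 * ni) ℤ.* + suc n1) ℤ.* + 1 ℤ.+ + (2 * ni) ℤ.* + suc n1 ≡ + (n2 * nj)
    left = begin
      (+ n2 ℤ.* + nj ℤ.+ ℤ.- + (2 * ni) ℤ.* + suc n1) ℤ.* + 1 ℤ.+ + (2 * ni) ℤ.* + suc n1
        ≡⟨ ring (+ n2) (+ nj) (+ (2 * ni)) (+ suc n1) ⟩
      + n2 ℤ.* + nj
        ≡⟨ ℤP.pos-* n2 nj ⟨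
      + (n2 * nj)
        ∎
      where
      open ≡-Reasoning
      ring : ∀ a b c d → (a ℤ.* b ℤ.+ ℤ.- c ℤ.* d) ℤ.* + 1 ℤ.+ c ℤ.* d ≡ a ℤ.* b
      ring = ℤ-Solver.solve-∀
    right : + 1 ℤ.* + (suc n1 * nj) ℤ.+ + (2 * ni) ℤ.* + suc n1 ≡ + (suc n1 * nj + 2 * ni * suc n1)
    right = begin
      + 1 ℤ.* + (suc n1 * nj) ℤ.+ + (2 * ni) ℤ.* + suc n1
        ≡⟨ cong₂ ℤ._+_ (ℤP.*-identityˡ (+ (suc n1 * nj))) (sym (ℤP.pos-* (2 * ni) (suc n1))) ⟩
      + (suc n1 * nj) ℤ.+ + (2 * ni * suc n1)
        ≡⟨ ℤP.pos-+ (suc n1 * nj) (2 * ni * suc n1) ⟨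
      + (suc n1 * nj + 2 * ni * suc n1)
        ∎
      where open ≡-Reasoning

open Fractions using (condA⇔; condB⇔)

-- Symmetric association schemes

1<∣Fin∣ : ∀ {m} {a b : Fin m} → a ≢ b → 1 < m
1<∣Fin∣ {suc zero}    {zero} {zero} a≢b = ⊥-elim (a≢b refl)
1<∣Fin∣ {suc (suc m)} _                 = s≤s (s≤s z≤n)

another : ∀ {m} → 1 < m → (a : Fin m) → ∃[ b ] b ≢ a
another {suc zero}    (s≤s ()) _
another {suc (suc m)} _ zero    = suc zero , λ ()
another {suc (suc m)} _ (suc a) = zero , λ ()

IsProperDDG⇒IsDDG : ∀ {v} {adj : Fin v → Fin v → Bool} → IsProperDDG adj → IsDDG adj
IsProperDDG⇒IsDDG (k , λ₁ , λ₂ , m , n , cls , D , _) = k , λ₁ , λ₂ , m , n , cls , D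

module SymmetricScheme {v k : ℕ} (X : AssocScheme v k)
  (col-sym : ∀ x y → AssocScheme.col X x y ≡ AssocScheme.col X y x) where
  open AssocScheme X

  Colour : Set
  Colour = Fin (suc k)

  ∑-by-colour : ∀ x t (h : Colour → ℕ) → ∑[ y < v ] (𝟙 (col x y == t) * h (col x y)) ≡ val t * h t
  ∑-by-colour x t h = begin
    ∑[ y < v ] (𝟙 (col x y == t) * h (col x y)) ≡⟨ ∑-cong (λ y → 𝟙==-subst (col x y)) ⟩
    ∑[ y < v ] (𝟙 (col x y == t) * h t)         ≡⟨ *-distribʳ-sum {v} (h t) (λ y → 𝟙 (col x y == t)) ⟨
    ∑[ y < v ] 𝟙 (col x y == t) * h t           ≡⟨ cong (_* h t) (count≡∑ (λ y → col x y == t)) ⟨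
    count (λ y → col x y == t) * h t            ≡⟨ cong (_* h t) (val-spec t x) ⟩
    val t * h t                                 ∎
    where
    open ≡-Reasoning
    𝟙==-subst : ∀ c → 𝟙 (c == t) * h c ≡ 𝟙 (c == t) * h t
    𝟙==-subst c with c ≟ t
    ... | yes refl = refl
    ... | no _     = refl

  path-sum : ∀ x y r s → ∑[ z < v ] 𝟙 ((col x z == r) ∧ (col z y == s)) ≡ inum r s (col x y)
  path-sum x y r s = trans (sym (count≡∑ (λ z → (col x z == r) ∧ (col z y == s)))) (inum-spec r s x y)

  col==0 : ∀ x y → (col x y == zero) ≡ (x == y)
  col==0 x y = T-ext (≡⇒== ∘ to (diag x y) ∘ ==⇒≡) (≡⇒== ∘ from (diag x y) ∘ ==⇒≡)

  inum-sym : ∀ r s t → inum r s t ≡ inum s r t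
  inum-sym r s t with x , y , refl ← nonempty t = begin
    inum r s (col x y)                              ≡⟨ inum-spec r s x y ⟨
    count (λ z → (col x z == r) ∧ (col z y == s))   ≡⟨ count-cong swap ⟩
    count (λ z → (col y z == s) ∧ (col z x == r))   ≡⟨ inum-spec s r y x ⟩
    inum s r (col y x)                              ≡⟨ cong (inum s r) (col-sym y x) ⟩
    inum s r (col x y)                              ∎
    where
    open ≡-Reasoning
    swap : ∀ z → ((col x z == r) ∧ (col z y == s)) ≡ ((col y z == s) ∧ (col z x == r))
    swap z rewrite col-sym x z | col-sym z y = ∧-comm (col z x == r) (col y z == s)

  val*inum : ∀ r s t → val t * inum r s t ≡ val r * inum s t r
  val*inum r s t = begin
    val t * inum r s t
      ≡⟨ ∑-by-colour x t (inum r s) ⟨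
    ∑[ y < v ] (𝟙 (col x y == t) * inum r s (col x y))
      ≡⟨ ∑-cong (λ y → cong (𝟙 (col x y == t) *_) (sym (path-sum x y r s))) ⟩
    ∑[ y < v ] (𝟙 (col x y == t) * ∑[ z < v ] 𝟙 ((col x z == r) ∧ (col z y == s)))
      ≡⟨ ∑-cong (λ y → *-distribˡ-sum {v} (𝟙 (col x y == t)) _) ⟩
    ∑[ y < v ] ∑[ z < v ] (𝟙 (col x y == t) * 𝟙 ((col x z == r) ∧ (col z y == s)))
      ≡⟨ ∑-comm {v} {v} _ ⟩
    ∑[ z < v ] ∑[ y < v ] (𝟙 (col x y == t) * 𝟙 ((col x z == r) ∧ (col z y == s)))
      ≡⟨ ∑-cong (λ z → ∑-cong (λ y → rotate z y)) ⟩
    ∑[ z < v ] ∑[ y < v ] (𝟙 (col x z == r) * 𝟙 ((col z y == s) ∧ (col y x == t)))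
      ≡⟨ ∑-cong (λ z → *-distribˡ-sum {v} (𝟙 (col x z == r)) _) ⟨
    ∑[ z < v ] (𝟙 (col x z == r) * ∑[ y < v ] 𝟙 ((col z y == s) ∧ (col y x == t)))
      ≡⟨ ∑-cong (λ z → cong (𝟙 (col x z == r) *_) (trans (path-sum z x s t) (cong (inum s t) (col-sym z x)))) ⟩
    ∑[ z < v ] (𝟙 (col x z == r) * inum s t (col x z))
      ≡⟨ ∑-by-colour x r (inum s t) ⟩
    val r * inum s t r
      ∎
    where
    open ≡-Reasoning
    x : Fin v
    x = proj₁ (nonempty t)
    rotate : ∀ z y → 𝟙 (col x y == t) * 𝟙 ((col x z == r) ∧ (col z y == s))
                   ≡ 𝟙 (col x z == r) * 𝟙 ((col z y == s) ∧ (col y x == t))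
    rotate z y rewrite col-sym y x | 𝟙-∧ (col x z == r) (col z y == s) | 𝟙-∧ (col z y == s) (col x y == t) =
      x∙yz≈y∙zx (𝟙 (col x y == t)) (𝟙 (col x z == r)) (𝟙 (col z y == s))

  ∑-inum : ∀ s t → ∑[ u < suc k ] inum s u t ≡ val s
  ∑-inum s t with x , y , refl ← nonempty t = begin
    ∑[ u < suc k ] inum s u (col x y)
      ≡⟨ ∑-cong (λ u → path-sum x y s u) ⟨
    ∑[ u < suc k ] ∑[ z < v ] 𝟙 ((col x z == s) ∧ (col z y == u))
      ≡⟨ ∑-comm (λ u z → 𝟙 ((col x z == s) ∧ (col z y == u))) ⟩
    ∑[ z < v ] ∑[ u < suc k ] 𝟙 ((col x z == s) ∧ (col z y == u))
      ≡⟨ ∑-cong (λ z → ∑-cong (λ u → cong 𝟙 (∧-comm (col x z == s) (col z y == u)))) ⟩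
    ∑[ z < v ] ∑[ u < suc k ] 𝟙 ((col z y == u) ∧ (col x z == s))
      ≡⟨ ∑-cong (λ z → ∑-select-∧ (col z y) (col x z == s)) ⟩
    ∑[ z < v ] 𝟙 (col x z == s)
      ≡⟨ trans (sym (count≡∑ (λ z → col x z == s))) (val-spec s x) ⟩
    val s
      ∎
    where open ≡-Reasoning

  inum-diagʳ : ∀ r t → inum r zero t ≡ 𝟙 (t == r)
  inum-diagʳ r t with x , y , refl ← nonempty t = begin
    inum r zero (col x y)                              ≡⟨ inum-spec r zero x y ⟨
    count (λ z → (col x z == r) ∧ (col z y == zero))   ≡⟨ count-cong (λ z → cong ((col x z == r) ∧_) (col==0 z y)) ⟩
    count (λ z → (col x z == r) ∧ (z == y))            ≡⟨ count-∧-== (λ z → col x z == r) y ⟩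
    𝟙 (col x y == r)                                   ∎
    where open ≡-Reasoning

  val-diag : val zero ≡ 1
  val-diag = begin
    val zero                             ≡⟨ val-spec zero x ⟨
    count (λ y → col x y == zero)        ≡⟨ count-cong (λ y → trans (cong (_== zero) (col-sym x y)) (col==0 y x)) ⟩
    count (λ y → true ∧ (y == x))        ≡⟨ count-∧-== (λ _ → true) x ⟩
    1                                    ∎
    where
    open ≡-Reasoning
    x : Fin v
    x = proj₁ (nonempty zero)

  val>0 : ∀ t → 0 < val t
  val>0 t with x , y , xy∈t ← nonempty t =
    subst (0 <_) (val-spec t x) (∃⇒count>0 (λ z → col x z == t) (≡⇒== xy∈t))

  ∑-val*inum : ∀ r s → ∑[ u < suc k ] (val u * inum r s u) ≡ val r * val s
  ∑-val*inum r s = begin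
    ∑[ u < suc k ] (val u * inum r s u)   ≡⟨ ∑-cong (val*inum r s) ⟩
    ∑[ u < suc k ] (val r * inum s u r)   ≡⟨ *-distribˡ-sum {suc k} (val r) (λ u → inum s u r) ⟨
    val r * ∑[ u < suc k ] inum s u r     ≡⟨ cong (val r *_) (∑-inum s r) ⟩
    val r * val s                         ∎
    where open ≡-Reasoning

  inum>0⇒path : ∀ {r s t x y} → 0 < inum r s t → col x y ≡ t → ∃[ z ] col x z ≡ r × col z y ≡ s
  inum>0⇒path {r} {s} {t} {x} {y} pos refl
    with z , rs ← count>0⇒∃ (λ z → (col x z == r) ∧ (col z y == s)) (subst (0 <_) (sym (inum-spec r s x y)) pos)
    = z , ==⇒≡ (proj₁ (to T-∧ rs)) , ==⇒≡ (proj₂ (to T-∧ rs))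

  inum≡0 : ∀ {r s t} → (∀ {x y z} → col x z ≡ r → col z y ≡ s → col x y ≢ t) → inum r s t ≡ 0
  inum≡0 {r} {s} {t} no-path with x , y , xy∈t ← nonempty t =
    n≤0⇒n≡0 (≮⇒≥ λ pos → let z , xz , zy = inum>0⇒path pos xy∈t in no-path xz zy xy∈t)

  valency : (Colour → Bool) → ℕ
  valency P = ∑[ u < suc k ] (𝟙 (P u) * val u)

  inum∪ : (Colour → Bool) → Colour → Colour → ℕ
  inum∪ P j t = ∑[ u < suc k ] (𝟙 (P u) * inum u j t)

  count-colours : ∀ (P : Colour → Bool) x → count (λ y → P (col x y)) ≡ valency P
  count-colours P x = begin
    count (λ y → P (col x y))
      ≡⟨ count≡∑ (λ y → P (col x y)) ⟩
    ∑[ y < v ] 𝟙 (P (col x y))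
      ≡⟨ ∑-cong (λ y → ∑-select (col x y) (λ u → 𝟙 (P u))) ⟨
    ∑[ y < v ] ∑[ u < suc k ] (𝟙 (col x y == u) * 𝟙 (P u))
      ≡⟨ ∑-comm (λ y u → 𝟙 (col x y == u) * 𝟙 (P u)) ⟩
    ∑[ u < suc k ] ∑[ y < v ] (𝟙 (col x y == u) * 𝟙 (P u))
      ≡⟨ ∑-cong (λ u → trans (∑-by-colour x u (λ _ → 𝟙 (P u))) (*-comm (val u) _)) ⟩
    ∑[ u < suc k ] (𝟙 (P u) * val u)
      ∎
    where open ≡-Reasoning

  count-paths : ∀ (P : Colour → Bool) j x y → count (λ w → P (col x w) ∧ (col w y == j)) ≡ inum∪ P j (col x y)
  count-paths P j x y = begin
    count (λ w → P (col x w) ∧ (col w y == j))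
      ≡⟨ count≡∑ (λ w → P (col x w) ∧ (col w y == j)) ⟩
    ∑[ w < v ] 𝟙 (P (col x w) ∧ (col w y == j))
      ≡⟨ ∑-cong (λ w → ∑-select (col x w) (λ u → 𝟙 (P u ∧ (col w y == j)))) ⟨
    ∑[ w < v ] ∑[ u < suc k ] (𝟙 (col x w == u) * 𝟙 (P u ∧ (col w y == j)))
      ≡⟨ ∑-comm (λ w u → 𝟙 (col x w == u) * 𝟙 (P u ∧ (col w y == j))) ⟩
    ∑[ u < suc k ] ∑[ w < v ] (𝟙 (col x w == u) * 𝟙 (P u ∧ (col w y == j)))
      ≡⟨ ∑-cong (λ u → ∑-cong (λ w → select u w)) ⟩
    ∑[ u < suc k ] ∑[ w < v ] (𝟙 (P u) * 𝟙 ((col x w == u) ∧ (col w y == j)))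
      ≡⟨ ∑-cong (λ u → *-distribˡ-sum (𝟙 (P u)) (λ w → 𝟙 ((col x w == u) ∧ (col w y == j)))) ⟨
    ∑[ u < suc k ] (𝟙 (P u) * ∑[ w < v ] 𝟙 ((col x w == u) ∧ (col w y == j)))
      ≡⟨ ∑-cong (λ u → cong (𝟙 (P u) *_) (path-sum x y u j)) ⟩
    ∑[ u < suc k ] (𝟙 (P u) * inum u j (col x y))
      ∎
    where
    open ≡-Reasoning
    select : ∀ u w → 𝟙 (col x w == u) * 𝟙 (P u ∧ (col w y == j)) ≡ 𝟙 (P u) * 𝟙 ((col x w == u) ∧ (col w y == j))
    select u w with col x w ≟ u
    ... | yes refl = trans (+-identityʳ _) (𝟙-∧ (P u) (col w y == j))
    ... | no _     = sym (*-zeroʳ (𝟙 (P u)))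

  module Parabolic (P : Colour → Bool) (P-parabolic : IsParabolic X P) where

    P-refl : ∀ x → T (P (col x x))
    P-refl = proj₁ P-parabolic

    P-sym : ∀ {x y} → T (P (col x y)) → T (P (col y x))
    P-sym = proj₁ (proj₂ P-parabolic) _ _

    P-trans : ∀ {x y z} → T (P (col x y)) → T (P (col y z)) → T (P (col x z))
    P-trans = proj₂ (proj₂ P-parabolic) _ _ _

    P-class : ∀ {x z} → T (P (col x z)) → ∀ w → P (col x w) ≡ P (col z w)
    P-class xz w = T-ext (P-trans (P-sym xz)) (P-trans xz)

    inum-closed : ∀ {r s t} → T (P r) → T (P s) → ¬ T (P t) → inum r s t ≡ 0
    inum-closed Pr Ps ¬Pt = inum≡0 λ { refl refl refl → ¬Pt (P-trans Pr Ps) }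

    inum-escape : ∀ {r s t} → T (P r) → ¬ T (P s) → T (P t) → inum r s t ≡ 0
    inum-escape Pr ¬Ps Pt = inum≡0 λ { refl refl refl → ¬Ps (P-trans (P-sym Pr) Pt) }

    inum∪-class : ∀ j {x z} → T (P (col x z)) → ∀ y → inum∪ P j (col x y) ≡ inum∪ P j (col z y)
    inum∪-class j {x} {z} xz y = begin
      inum∪ P j (col x y)                          ≡⟨ count-paths P j x y ⟨
      count (λ w → P (col x w) ∧ (col w y == j))   ≡⟨ count-cong (λ w → cong (_∧ (col w y == j)) (P-class xz w)) ⟩
      count (λ w → P (col z w) ∧ (col w y == j))   ≡⟨ count-paths P j z y ⟩
      inum∪ P j (col z y)                          ∎
      where open ≡-Reasoning

  ≢⇒col≢0 : ∀ {x y} → x ≢ y → col x y ≢ zero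
  ≢⇒col≢0 x≢y = x≢y ∘ to (diag _ _)

  col≢0⇒≢ : ∀ {x y} → col x y ≢ zero → x ≢ y
  col≢0⇒≢ c≢0 refl = c≢0 (from (diag _ _) refl)

  _∪_ : Colour → Colour → Fin v → Fin v → Bool
  (r ∪ s) x y = (col x y == r) ∨ (col x y == s)

  ∪-regular : ∀ {r s} → r ≢ s → ∀ x → count ((r ∪ s) x) ≡ val r + val s
  ∪-regular {r} {s} r≢s x =
    trans (count-∨ (λ y → col x y == r) (λ y → col x y == s) (==-disjoint r≢s ∘ col x))
          (cong₂ _+_ (val-spec r x) (val-spec s x))

  ∪-common : ∀ {r s} → r ≢ s → ∀ x y → commonNbrs (r ∪ s) x y ≡
    inum r r (col x y) + inum r s (col x y) + inum s r (col x y) + inum s s (col x y)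
  ∪-common {r} {s} r≢s x y = begin
    count (λ z → (r ∪ s) x z ∧ (r ∪ s) y z)
      ≡⟨ count≡∑ (λ z → (r ∪ s) x z ∧ (r ∪ s) y z) ⟩
    ∑ (λ z → 𝟙 ((r ∪ s) x z ∧ (r ∪ s) y z))
      ≡⟨ ∑-cong (λ z → trans (cong (λ c → 𝟙 ((r ∪ s) x z ∧ ((c == r) ∨ (c == s)))) (col-sym y z))
                              (𝟙-∨∧∨ _ _ _ _ (==-disjoint r≢s (col x z)) (==-disjoint r≢s (col z y)))) ⟩
    ∑ (λ z → paths r r z + paths r s z + paths s r z + paths s s z)
      ≡⟨ ∑-distrib-+ (λ z → paths r r z + paths r s z + paths s r z) (paths s s) ⟩
    ∑ (λ z → paths r r z + paths r s z + paths s r z) + ∑ (paths s s)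
      ≡⟨ cong (_+ ∑ (paths s s)) (∑-distrib-+ (λ z → paths r r z + paths r s z) (paths s r)) ⟩
    ∑ (λ z → paths r r z + paths r s z) + ∑ (paths s r) + ∑ (paths s s)
      ≡⟨ cong (λ a → a + ∑ (paths s r) + ∑ (paths s s)) (∑-distrib-+ (paths r r) (paths r s)) ⟩
    ∑ (paths r r) + ∑ (paths r s) + ∑ (paths s r) + ∑ (paths s s)
      ≡⟨ cong₂ _+_ (cong₂ _+_ (cong₂ _+_ (path-sum x y r r) (path-sum x y r s)) (path-sum x y s r)) (path-sum x y s s) ⟩
    inum r r (col x y) + inum r s (col x y) + inum s r (col x y) + inum s s (col x y)
      ∎
    where
    open ≡-Reasoning
    paths : Colour → Colour → Fin v → ℕ
    paths a b z = 𝟙 ((col x z == a) ∧ (col z y == b))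

  SameClass : ∀ {m} → (Fin v → Fin m) → Colour → Set
  SameClass cls t = ∀ {x y} → col x y ≡ t → cls x ≡ cls y

  SameClass-closed : ∀ {m} {cls : Fin v → Fin m} {r s t} → 0 < inum r s t →
    SameClass cls r → SameClass cls s → SameClass cls t
  SameClass-closed pos same-r same-s xy∈t with z , xz , zy ← inum>0⇒path pos xy∈t = trans (same-r xz) (same-s zy)

  module ColourGraph (adj : Fin v → Fin v → Bool) (Λ : Colour → ℕ)
    (common : ∀ x y → commonNbrs adj x y ≡ Λ (col x y)) where

    module Canonical {deg λ₁ λ₂ m n} {cls : Fin v → Fin m} (D : IsDDGWith adj deg λ₁ λ₂ m n cls) where
      open IsDDGWith D

      Λ-same : ∀ {x y} → col x y ≢ zero → cls x ≡ cls y → Λ (col x y) ≡ λ₁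
      Λ-same c≢0 eq = trans (sym (common _ _)) (sameClass _ _ (col≢0⇒≢ c≢0) eq)

      Λ-split : ∀ {x y} → cls x ≢ cls y → Λ (col x y) ≡ λ₂
      Λ-split neq = trans (sym (common _ _)) (diffClass _ _ neq)

      data Kind (t : Colour) : Set where
        same  : SameClass cls t → Λ t ≡ λ₁ → Kind t
        split : ¬ SameClass cls t → Λ t ≡ λ₂ → Kind t

      kind : λ₁ ≢ λ₂ → ∀ t → t ≢ zero → Kind t
      kind λ₁≢λ₂ t t≢0 with x , y , refl ← nonempty t | cls x ≟ cls y
      ... | yes eq  = same same-class (Λ-same t≢0 eq)
        where
        same-class : SameClass cls (col x y)
        same-class {a} {b} ab∈t with cls a ≟ cls b
        ... | yes eq′ = eq′
        ... | no neq′ = ⊥-elim (λ₁≢λ₂ (trans (sym (Λ-same t≢0 eq)) (trans (cong Λ (sym ab∈t)) (Λ-split neq′))))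
      ... | no  neq = split (λ same-class → neq (same-class refl)) (Λ-split neq)

      Λ-uniform : λ₁ ≡ λ₂ → ∀ t → t ≢ zero → Λ t ≡ λ₁
      Λ-uniform λ₁≡λ₂ t t≢0 with x , y , refl ← nonempty t | cls x ≟ cls y
      ... | yes eq  = Λ-same t≢0 eq
      ... | no  neq = trans (Λ-split neq) (sym λ₁≡λ₂)

    DDGOn : (Colour → Bool) → ℕ → ℕ → ℕ → Set
    DDGOn P deg λ₁ λ₂ = Σ ℕ λ m → Σ (Fin v → Fin m) λ cls →
      IsDDGWith adj deg λ₁ λ₂ m (valency P) cls × (∀ x y → (cls x ≡ cls y) ⇔ T (P (col x y)))

    parabolic-DDG : IsGraph adj → ∀ {deg} → (∀ x → count (adj x) ≡ deg) →
      ∀ P → IsParabolic X P → ∀ {λ₁ λ₂} →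
      (∀ {t} → t ≢ zero → T (P t) → Λ t ≡ λ₁) → (∀ {t} → ¬ T (P t) → Λ t ≡ λ₂) →
      DDGOn P deg λ₁ λ₂
    parabolic-DDG graph regular P P-parabolic Λ-inside Λ-outside = classes , index , ddg , index⇔R
      where
      open Parabolic P P-parabolic
      open EquivalenceClasses (λ x y → P (col x y)) P-refl P-sym P-trans
      ddg : IsDDGWith adj _ _ _ classes (valency P) index
      ddg = record
        { graph     = graph
        ; regular   = regular
        ; classSize = index-size (count-colours P)
        ; sameClass = λ x y x≢y eq → trans (common x y) (Λ-inside (≢⇒col≢0 x≢y) (to (index⇔R x y) eq))
        ; diffClass = λ x y neq → trans (common x y) (Λ-outside (neq ∘ from (index⇔R x y)))
        }

    DDGOn⇒IsDDG : ∀ {P deg λ₁ λ₂} → DDGOn P deg λ₁ λ₂ → IsDDG adj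
    DDGOn⇒IsDDG {P} {deg} {λ₁} {λ₂} (m , cls , D , _) = deg , λ₁ , λ₂ , m , valency P , cls , D

    DDGOn⇒IsDDGPart : ∀ {P deg λ₁ λ₂} → DDGOn P deg λ₁ λ₂ → IsDDGPart adj (λ x y → T (P (col x y)))
    DDGOn⇒IsDDGPart {P} {deg} {λ₁} {λ₂} (m , cls , D , cls⇔P) = deg , λ₁ , λ₂ , m , valency P , cls , D , cls⇔P

    DDGOn⇒IsProperDDG : ∀ {P deg λ₁ λ₂} → DDGOn P deg λ₁ λ₂ → ∀ {t} → ¬ T (P t) →
      1 < valency P → λ₁ ≢ λ₂ → IsProperDDG adj
    DDGOn⇒IsProperDDG {P} {deg} {λ₁} {λ₂} (m , cls , D , cls⇔P) {t} t∉P n>1 λ₁≢λ₂ =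
      deg , λ₁ , λ₂ , m , valency P , cls , D , 1<∣Fin∣ classes-differ , n>1 , λ₁≢λ₂
      where
      x y : Fin v
      x = proj₁ (nonempty t)
      y = proj₁ (proj₂ (nonempty t))
      classes-differ : cls x ≢ cls y
      classes-differ eq = t∉P (subst (T ∘ P) (proj₂ (proj₂ (nonempty t))) (to (cls⇔P x y) eq))

    IsProperDDG⇒nonconstant : IsProperDDG adj → ∀ {ℓ} → ¬ (∀ {t} → t ≢ zero → Λ t ≡ ℓ)
    IsProperDDG⇒nonconstant (_ , λ₁ , λ₂ , m , n , cls , D , m>1 , n>1 , λ₁≢λ₂) {ℓ} constant =
      λ₁≢λ₂ (λ₁≡λ₂ (proj₁ (nonempty zero)))
      where
      open IsDDGWith D
      open Canonical D
      λ₁≡λ₂ : Fin v → λ₁ ≡ λ₂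
      λ₁≡λ₂ x
        with y , y≢x , y∼x ← count>1⇒another (λ z → cls z == cls x) (≡⇒== {a = cls x} refl)
                                                (subst (1 <_) (sym (classSize (cls x))) n>1)
           | b , b≢cls-x ← another m>1 (cls x)
        with z , z∈b ← count>0⇒∃ (λ z → cls z == b) (subst (0 <_) (sym (classSize b)) (≤-trans (s≤s z≤n) n>1))
        = begin
          λ₁           ≡⟨ Λ-same (≢⇒col≢0 y≢x) (==⇒≡ {a = cls y} y∼x) ⟨
          Λ (col y x)  ≡⟨ constant (≢⇒col≢0 y≢x) ⟩
          ℓ            ≡⟨ constant (≢⇒col≢0 z≢x) ⟨
          Λ (col z x)  ≡⟨ Λ-split cls-z≢cls-x ⟩
          λ₂           ∎
        where
        open ≡-Reasoning
        cls-z≢cls-x : cls z ≢ cls x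
        cls-z≢cls-x eq = b≢cls-x (trans (sym (==⇒≡ {a = cls z} z∈b)) eq)
        z≢x : z ≢ x
        z≢x z≡x = cls-z≢cls-x (cong cls z≡x)

-- Higmanian schemes

Outer : Fin 5 → Set
Outer j = j ≡ s3 ⊎ j ≡ s4

outer∉e1 : ∀ {j} → Outer j → ¬ T (inE1 j)
outer∉e1 (inj₁ refl) ()
outer∉e1 (inj₂ refl) ()

e1≢outer : ∀ {c j} → T (inE1 c) → Outer j → c ≢ j
e1≢outer c∈e1 oj refl = outer∉e1 oj c∈e1

∉e1⇒outer : ∀ c → ¬ T (inE1 c) → Outer c
∉e1⇒outer zero                         c∉e1 = ⊥-elim (c∉e1 tt)
∉e1⇒outer (suc zero)                   c∉e1 = ⊥-elim (c∉e1 tt)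
∉e1⇒outer (suc (suc zero))             c∉e1 = ⊥-elim (c∉e1 tt)
∉e1⇒outer (suc (suc (suc zero)))       _    = inj₁ refl
∉e1⇒outer (suc (suc (suc (suc zero)))) _    = inj₂ refl

outer-split : ∀ {j c} → Outer j → Outer c → c ≡ j ⊎ c ≡ other j
outer-split (inj₁ refl) (inj₁ refl) = inj₁ refl
outer-split (inj₁ refl) (inj₂ refl) = inj₂ refl
outer-split (inj₂ refl) (inj₁ refl) = inj₂ refl
outer-split (inj₂ refl) (inj₂ refl) = inj₁ refl

e0⊆e1 : ∀ {c} → T (inE0 c) → T (inE1 c)
e0⊆e1 {zero}     _ = tt
e0⊆e1 {suc zero} _ = tt

∑₅ : (f : Fin 5 → ℕ) → ∑[ u < 5 ] f u ≡ f s0 + f s1 + f s2 + f s3 + f s4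
∑₅ f = normalise (f s0) (f s1) (f s2) (f s3) (f s4)
  where
  normalise : ∀ a b c d e → a + (b + (c + (d + (e + 0)))) ≡ a + b + c + d + e
  normalise = solve-∀

∑-e0 : (f : Fin 5 → ℕ) → ∑[ u < 5 ] (𝟙 (inE0 u) * f u) ≡ f s0 + f s1
∑-e0 f = normalise (f s0) (f s1)
  where
  normalise : ∀ a b → (a + 0) + ((b + 0) + (0 + (0 + (0 + 0)))) ≡ a + b
  normalise = solve-∀

∑-e1 : (f : Fin 5 → ℕ) → ∑[ u < 5 ] (𝟙 (inE1 u) * f u) ≡ f s0 + f s1 + f s2
∑-e1 f = normalise (f s0) (f s1) (f s2)
  where
  normalise : ∀ a b c → (a + 0) + ((b + 0) + ((c + 0) + (0 + (0 + 0)))) ≡ a + b + c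
  normalise = solve-∀

module Higmanian {v : ℕ} (X : AssocScheme v 4) (H : IsHigmanianStd X) where
  open AssocScheme X
  open IsHigmanianStd H
  open SymmetricScheme X symmetric public

  module E0 = Parabolic inE0 e0-parabolic
  module E1 = Parabolic inE1 e1-parabolic

  radical : ∀ {j} → Outer j → RadTrivial X j
  radical (inj₁ refl) = rad3
  radical (inj₂ refl) = rad4

  inum-outer-e1 : ∀ {j u w} → Outer j → T (inE1 u) → T (inE1 w) → inum j u w ≡ 0
  inum-outer-e1 {j} {u} {w} oj u∈e1 w∈e1 = trans (inum-sym j u w) (E1.inum-escape u∈e1 (outer∉e1 oj) w∈e1)

  outer-weights : ∀ {j u} → Outer j → T (inE1 u) →
    val s3 * inum u j s3 + val s4 * inum u j s4 ≡ val j * val u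
  outer-weights {j} {u} oj u∈e1 = begin
    val s3 * inum u j s3 + val s4 * inum u j s4
      ≡⟨ cong₂ (λ a b → val s3 * a + val s4 * b) (inum-sym u j s3) (inum-sym u j s4) ⟩
    val s3 * inum j u s3 + val s4 * inum j u s4
      ≡⟨ pad (val s0) (val s1) (val s2) _ _ (vanish tt) (vanish tt) (vanish tt) ⟩
    val s0 * inum j u s0 + val s1 * inum j u s1 + val s2 * inum j u s2 + val s3 * inum j u s3 + val s4 * inum j u s4
      ≡⟨ ∑₅ (λ w → val w * inum j u w) ⟨
    ∑[ w < 5 ] (val w * inum j u w)
      ≡⟨ ∑-val*inum j u ⟩
    val j * val u
      ∎
    where
    open ≡-Reasoning
    vanish : ∀ {w} → T (inE1 w) → inum j u w ≡ 0
    vanish = inum-outer-e1 oj u∈e1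
    pad : ∀ a0 a1 a2 {c0 c1 c2} x y → c0 ≡ 0 → c1 ≡ 0 → c2 ≡ 0 →
      x + y ≡ a0 * c0 + a1 * c1 + a2 * c2 + x + y
    pad a0 a1 a2 x y refl refl refl = zeros a0 a1 a2 x y
      where
      zeros : ∀ a0 a1 a2 x y → x + y ≡ a0 * 0 + a1 * 0 + a2 * 0 + x + y
      zeros = solve-∀

  module InnerParabolic (P : Fin 5 → Bool) (P-parabolic : IsParabolic X P)
    (P∋s1 : T (P s1)) (P⊆e1 : ∀ {c} → T (P c) → T (inE1 c)) where
    open Parabolic P P-parabolic

    -- Otherwise P s_j = s_j P = s_j (by stays), so rad(s_j) = 1_V would force P ⊆ 1_V, but s1 ⊆ P.
    inum∪-other : ∀ {j} → Outer j → inum∪ P j (other j) ≡ inum∪ P j j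
    inum∪-other {j} oj with inum∪ P j (other j) ℕ.≟ inum∪ P j j
    ... | yes eq  = eq
    ... | no  neq =
      ⊥-elim (col≢0⇒≢ s1≢s0 (radical oj (λ a b → P (col a b)) left right x y (subst (T ∘ P) (sym xy∈s1) P∋s1)))
      where
      x y : Fin v
      x = proj₁ (nonempty s1)
      y = proj₁ (proj₂ (nonempty s1))
      xy∈s1 : col x y ≡ s1
      xy∈s1 = proj₂ (proj₂ (nonempty s1))
      s1≢s0 : col x y ≢ zero
      s1≢s0 xy∈s0 = case trans (sym xy∈s1) xy∈s0 of λ ()

      stays : ∀ {x y z} → T (P (col x z)) → col z y ≡ j → col x y ≡ j
      stays {x} {y} {z} xz zy with outer-split oj (∉e1⇒outer (col x y) leaves-e1)
        where
        leaves-e1 : ¬ T (inE1 (col x y))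
        leaves-e1 xy∈e1 = outer∉e1 oj (subst (T ∘ inE1) zy (E1.P-trans (E1.P-sym (P⊆e1 xz)) xy∈e1))
      ... | inj₁ xy≡j = xy≡j
      ... | inj₂ xy≡o = ⊥-elim (neq (begin
        inum∪ P j (other j) ≡⟨ cong (inum∪ P j) xy≡o ⟨
        inum∪ P j (col x y) ≡⟨ inum∪-class j xz y ⟩
        inum∪ P j (col z y) ≡⟨ cong (inum∪ P j) zy ⟩
        inum∪ P j j         ∎))
        where open ≡-Reasoning

      left : ∀ a b → (Σ (Fin v) λ z → T (P (col a z)) × col z b ≡ j) ⇔ (col a b ≡ j)
      left a b = mk⇔ (λ (z , az , zb) → stays az zb) (λ ab → a , P-refl a , ab)

      right : ∀ a b → (Σ (Fin v) λ z → col a z ≡ j × T (P (col z b))) ⇔ (col a b ≡ j)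
      right a b = mk⇔ (λ (z , az , zb) → trans (symmetric a b) (stays (P-sym zb) (trans (symmetric z a) az)))
                      (λ ab → b , ab , P-refl b)

    inum∪-outer : ∀ {j t} → Outer j → Outer t → inum∪ P j t ≡ inum∪ P j j
    inum∪-outer oj ot with outer-split oj ot
    ... | inj₁ refl = refl
    ... | inj₂ refl = inum∪-other oj

    valency-outer : ∀ {j} → Outer j → (val s3 + val s4) * inum∪ P j j ≡ val j * valency P
    valency-outer {j} oj = begin
      (val s3 + val s4) * inum∪ P j j
        ≡⟨ *-distribʳ-+ (inum∪ P j j) (val s3) (val s4) ⟩
      val s3 * inum∪ P j j + val s4 * inum∪ P j j
        ≡⟨ cong₂ (λ a b → val s3 * a + val s4 * b) (inum∪-outer oj (inj₁ refl)) (inum∪-outer oj (inj₂ refl)) ⟨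
      val s3 * inum∪ P j s3 + val s4 * inum∪ P j s4
        ≡⟨ ∑-linear (val s3) (val s4) (𝟙 ∘ P) (λ u → inum u j s3) (λ u → inum u j s4) ⟨
      ∑[ u < 5 ] (𝟙 (P u) * (val s3 * inum u j s3 + val s4 * inum u j s4))
        ≡⟨ ∑-restrict-cong P (λ u Pu → outer-weights {u = u} oj (P⊆e1 Pu)) ⟩
      ∑[ u < 5 ] (𝟙 (P u) * (val j * val u))
        ≡⟨ ∑-scale (val j) (𝟙 ∘ P) val ⟩
      val j * valency P
        ∎
      where open ≡-Reasoning

  module Inner₀ = InnerParabolic inE0 e0-parabolic tt (λ {c} → e0⊆e1 {c})
  module Inner₁ = InnerParabolic inE1 e1-parabolic tt (λ {c} c∈e1 → c∈e1)

  N : ℕ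
  N = val s3 + val s4

  val-sum : ∀ {j} → Outer j → val j + val (other j) ≡ N
  val-sum (inj₁ refl) = refl
  val-sum (inj₂ refl) = +-comm (val s4) (val s3)

  val-product : ∀ {j} → Outer j → val j * val (other j) ≡ val s3 * val s4
  val-product (inj₁ refl) = refl
  val-product (inj₂ refl) = *-comm (val s4) (val s3)

  β α d : Fin 5 → ℕ
  β j = inum∪ inE0 j j
  α j = inum∪ inE1 j j
  d j = inum s2 j j

  valency-e0 : valency inE0 ≡ 1 + val s1
  valency-e0 = trans (∑-e0 val) (cong (_+ val s1) val-diag)

  valency-e1 : valency inE1 ≡ 1 + val s1 + val s2
  valency-e1 = trans (∑-e1 val) (cong (λ n → n + val s1 + val s2) val-diag)

  inum∪-e1 : ∀ j t → inum∪ inE1 j t ≡ inum∪ inE0 j t + inum s2 j t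
  inum∪-e1 j t = trans (∑-e1 (λ u → inum u j t)) (cong (_+ inum s2 j t) (sym (∑-e0 (λ u → inum u j t))))

  N*β : ∀ {j} → Outer j → N * β j ≡ val j * (1 + val s1)
  N*β {j} oj = trans (Inner₀.valency-outer oj) (cong (val j *_) valency-e0)

  N*α : ∀ {j} → Outer j → N * α j ≡ val j * (1 + val s1 + val s2)
  N*α {j} oj = trans (Inner₁.valency-outer oj) (cong (val j *_) valency-e1)

  N*d : ∀ {j} → Outer j → N * d j ≡ val j * val s2
  N*d {j} oj = +-cancelˡ-≡ (N * β j) _ _ (begin
    N * β j + N * d j                  ≡⟨ *-distribˡ-+ N (β j) (d j) ⟨
    N * (β j + d j)                    ≡⟨ cong (N *_) (inum∪-e1 j j) ⟨
    N * α j                            ≡⟨ N*α oj ⟩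
    val j * (1 + val s1 + val s2)      ≡⟨ *-distribˡ-+ (val j) (1 + val s1) (val s2) ⟩
    val j * (1 + val s1) + val j * val s2 ≡⟨ cong (_+ val j * val s2) (N*β oj) ⟨
    N * β j + val j * val s2           ∎)
    where open ≡-Reasoning

  d-other : ∀ {j} → Outer j → inum s2 j (other j) ≡ d j
  d-other {j} oj = +-cancelˡ-≡ (β j) _ _ (begin
    β j + inum s2 j (other j)                  ≡⟨ cong (_+ inum s2 j (other j)) (Inner₀.inum∪-other oj) ⟨
    inum∪ inE0 j (other j) + inum s2 j (other j) ≡⟨ inum∪-e1 j (other j) ⟨
    inum∪ inE1 j (other j)                     ≡⟨ Inner₁.inum∪-other oj ⟩
    α j                                        ≡⟨ inum∪-e1 j j ⟩
    β j + d j                                  ∎)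
    where open ≡-Reasoning

  d>0 : ∀ {j} → Outer j → 0 < d j
  d>0 {j} oj = *>0⇒>0ʳ N (subst (0 <_) (sym (N*d oj)) (*-mono-≤ (val>0 j) (val>0 s2)))

  inum-2j-outer : ∀ {j t} → Outer j → Outer t → inum s2 j t ≡ d j
  inum-2j-outer oj ot with outer-split oj ot
  ... | inj₁ refl = refl
  ... | inj₂ refl = d-other oj

  inum-221 : inum s2 s2 s1 ≡ val s2
  inum-221 = begin
    inum s2 s2 s1
      ≡⟨ only-middle (inum-diagʳ s2 s1) (trans (inum-sym s2 s1 s1) (E0.inum-escape tt (λ ()) tt))
                     (E1.inum-escape tt (λ ()) tt) (E1.inum-escape tt (λ ()) tt) ⟩
    inum s2 s0 s1 + inum s2 s1 s1 + inum s2 s2 s1 + inum s2 s3 s1 + inum s2 s4 s1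
      ≡⟨ ∑₅ (λ u → inum s2 u s1) ⟨
    ∑[ u < 5 ] inum s2 u s1
      ≡⟨ ∑-inum s2 s1 ⟩
    val s2
      ∎
    where
    open ≡-Reasoning
    only-middle : ∀ {a b c d e} → a ≡ 0 → b ≡ 0 → d ≡ 0 → e ≡ 0 → c ≡ a + b + c + d + e
    only-middle {c = c} refl refl refl refl = sym (trans (+-identityʳ (c + 0)) (+-identityʳ c))

  inum-122 : inum s1 s2 s2 ≡ val s1
  inum-122 = *-cancelˡ-≡ _ _ (val s2) {{>-nonZero (val>0 s2)}} (begin
    val s2 * inum s1 s2 s2 ≡⟨ val*inum s1 s2 s2 ⟩
    val s1 * inum s2 s2 s1 ≡⟨ cong (val s1 *_) inum-221 ⟩
    val s1 * val s2        ≡⟨ *-comm (val s1) (val s2) ⟩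
    val s2 * val s1        ∎)
    where open ≡-Reasoning

  inum-222 : inum s2 s2 s2 + (1 + val s1) ≡ val s2
  inum-222 = begin
    inum s2 s2 s2 + (1 + val s1)
      ≡⟨ regroup (inum s2 s2 s2) (val s1) ⟩
    1 + val s1 + inum s2 s2 s2 + 0 + 0
      ≡⟨ cong₂ (λ a b → 1 + val s1 + inum s2 s2 s2 + a + b)
              (E1.inum-escape tt (λ ()) tt) (E1.inum-escape tt (λ ()) tt) ⟨
    1 + val s1 + inum s2 s2 s2 + inum s2 s3 s2 + inum s2 s4 s2
      ≡⟨ cong₂ (λ a b → a + b + inum s2 s2 s2 + inum s2 s3 s2 + inum s2 s4 s2)
              (inum-diagʳ s2 s2) (trans (inum-sym s2 s1 s2) inum-122) ⟨
    inum s2 s0 s2 + inum s2 s1 s2 + inum s2 s2 s2 + inum s2 s3 s2 + inum s2 s4 s2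
      ≡⟨ ∑₅ (λ u → inum s2 u s2) ⟨
    ∑[ u < 5 ] inum s2 u s2
      ≡⟨ ∑-inum s2 s2 ⟩
    val s2
      ∎
    where
    open ≡-Reasoning
    regroup : ∀ c n → c + (1 + n) ≡ 1 + n + c + 0 + 0
    regroup = solve-∀

  ∑-weights : ∀ (P : Fin 5 → Bool) j → ∑[ u < 5 ] (𝟙 (P u) * (val u * inum j j u)) ≡ val j * inum∪ P j j
  ∑-weights P j = begin
    ∑[ u < 5 ] (𝟙 (P u) * (val u * inum j j u))
      ≡⟨ ∑-cong (λ u → cong (𝟙 (P u) *_) (trans (val*inum j j u) (cong (val j *_) (inum-sym j u j)))) ⟩
    ∑[ u < 5 ] (𝟙 (P u) * (val j * inum u j j))
      ≡⟨ ∑-scale (val j) (𝟙 ∘ P) (λ u → inum u j j) ⟩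
    val j * inum∪ P j j
      ∎
    where open ≡-Reasoning

  diagonal-weight : ∀ j → val s0 * inum j j s0 ≡ val j
  diagonal-weight j = begin
    val s0 * inum j j s0 ≡⟨ val*inum j j s0 ⟩
    val j * inum j s0 j  ≡⟨ cong (val j *_) (trans (inum-diagʳ j j) (cong 𝟙 (dec-true (j ≟ j) refl))) ⟩
    val j * 1            ≡⟨ *-identityʳ (val j) ⟩
    val j                ∎
    where open ≡-Reasoning

  e0-weights : ∀ j → val j + val s1 * inum j j s1 ≡ val j * β j
  e0-weights j = begin
    val j + val s1 * inum j j s1                       ≡⟨ cong (_+ val s1 * inum j j s1) (diagonal-weight j) ⟨
    val s0 * inum j j s0 + val s1 * inum j j s1        ≡⟨ ∑-e0 (λ u → val u * inum j j u) ⟨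
    ∑[ u < 5 ] (𝟙 (inE0 u) * (val u * inum j j u))     ≡⟨ ∑-weights inE0 j ⟩
    val j * β j                                        ∎
    where open ≡-Reasoning

  e1-weights : ∀ j → val j + val s1 * inum j j s1 + val s2 * inum j j s2 ≡ val j * α j
  e1-weights j = begin
    val j + val s1 * inum j j s1 + val s2 * inum j j s2
      ≡⟨ cong (λ a → a + val s1 * inum j j s1 + val s2 * inum j j s2) (diagonal-weight j) ⟨
    val s0 * inum j j s0 + val s1 * inum j j s1 + val s2 * inum j j s2
      ≡⟨ ∑-e1 (λ u → val u * inum j j u) ⟨
    ∑[ u < 5 ] (𝟙 (inE1 u) * (val u * inum j j u))
      ≡⟨ ∑-weights inE1 j ⟩
    val j * α j
      ∎
    where open ≡-Reasoning

  all-weights : ∀ j → val j * α j + val s3 * inum j j s3 + val s4 * inum j j s4 ≡ val j * val j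
  all-weights j = begin
    val j * α j + val s3 * inum j j s3 + val s4 * inum j j s4
      ≡⟨ cong (λ a → a + val s3 * inum j j s3 + val s4 * inum j j s4)
              (trans (sym (∑-weights inE1 j)) (∑-e1 (λ u → val u * inum j j u))) ⟩
    val s0 * inum j j s0 + val s1 * inum j j s1 + val s2 * inum j j s2 + val s3 * inum j j s3 + val s4 * inum j j s4
      ≡⟨ ∑₅ (λ u → val u * inum j j u) ⟨
    ∑[ u < 5 ] (val u * inum j j u)
      ≡⟨ ∑-val*inum j j ⟩
    val j * val j
      ∎
    where open ≡-Reasoning

  outer-row : ∀ {j t} → Outer j → Outer t → α j + inum j s3 t + inum j s4 t ≡ val j
  outer-row {j} {t} oj ot = begin
    α j + inum j s3 t + inum j s4 t
      ≡⟨ cong (λ a → a + inum j s3 t + inum j s4 t) inner ⟩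
    inum j s0 t + inum j s1 t + inum j s2 t + inum j s3 t + inum j s4 t
      ≡⟨ ∑₅ (λ u → inum j u t) ⟨
    ∑[ u < 5 ] inum j u t
      ≡⟨ ∑-inum j t ⟩
    val j
      ∎
    where
    open ≡-Reasoning
    inner : α j ≡ inum j s0 t + inum j s1 t + inum j s2 t
    inner = begin
      α j                                      ≡⟨ Inner₁.inum∪-outer oj ot ⟨
      inum∪ inE1 j t                           ≡⟨ ∑-e1 (λ u → inum u j t) ⟩
      inum s0 j t + inum s1 j t + inum s2 j t
        ≡⟨ cong₂ _+_ (cong₂ _+_ (inum-sym s0 j t) (inum-sym s1 j t)) (inum-sym s2 j t) ⟩
      inum j s0 t + inum j s1 t + inum j s2 t  ∎

  inum-44-33 : inum s4 s4 s3 + inum s3 s3 s4 ≡ inum s4 s4 s4 + inum s3 s3 s3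
  inum-44-33 =
    exchange {inum s4 s4 s3} {inum s4 s4 s4} {inum s3 s4 s3} {inum s3 s4 s4} {inum s3 s3 s3} {inum s3 s3 s4}
    (+-cancelˡ-≡ (α s4) _ _ (begin
      α s4 + (inum s3 s4 s3 + inum s4 s4 s3) ≡⟨ cong (λ c → α s4 + (c + inum s4 s4 s3)) (inum-sym s3 s4 s3) ⟩
      α s4 + (inum s4 s3 s3 + inum s4 s4 s3) ≡⟨ +-assoc (α s4) _ _ ⟨
      α s4 + inum s4 s3 s3 + inum s4 s4 s3   ≡⟨ outer-row (inj₂ refl) (inj₁ refl) ⟩
      val s4                                 ≡⟨ outer-row (inj₂ refl) (inj₂ refl) ⟨
      α s4 + inum s4 s3 s4 + inum s4 s4 s4   ≡⟨ +-assoc (α s4) _ _ ⟩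
      α s4 + (inum s4 s3 s4 + inum s4 s4 s4) ≡⟨ cong (λ c → α s4 + (c + inum s4 s4 s4)) (inum-sym s4 s3 s4) ⟩
      α s4 + (inum s3 s4 s4 + inum s4 s4 s4) ∎))
    (+-cancelˡ-≡ (α s3) _ _ (begin
      α s3 + (inum s3 s3 s3 + inum s3 s4 s3) ≡⟨ +-assoc (α s3) _ _ ⟨
      α s3 + inum s3 s3 s3 + inum s3 s4 s3   ≡⟨ outer-row (inj₁ refl) (inj₁ refl) ⟩
      val s3                                 ≡⟨ outer-row (inj₁ refl) (inj₂ refl) ⟨
      α s3 + inum s3 s3 s4 + inum s3 s4 s4   ≡⟨ +-assoc (α s3) _ _ ⟩
      α s3 + (inum s3 s3 s4 + inum s3 s4 s4) ∎))
    where open ≡-Reasoning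

  inum-ii-balanced : ∀ {i} → Outer i → (inum i i s3 ≡ inum i i s4) ⇔ (inum s3 s3 s3 ≡ inum s3 s3 s4)
  inum-ii-balanced (inj₁ refl) = ⇔-refl
  inum-ii-balanced (inj₂ refl) = balanced-⇔ inum-44-33

  inum-j2-other>0 : ∀ {j} → Outer j → 0 < inum j s2 (other j)
  inum-j2-other>0 {j} oj = subst (0 <_) (sym (trans (inum-sym j s2 (other j)) (d-other oj))) (d>0 oj)

  inum-jj2>0 : ∀ {j} → Outer j → 0 < inum j j s2
  inum-jj2>0 {j} oj = *>0⇒>0ʳ (val s2) (subst (0 <_) (sym (val*inum j j s2))
    (*-mono-≤ (val>0 j) (subst (0 <_) (sym (inum-sym j s2 j)) (d>0 oj))))

  inum-221>0 : 0 < inum s2 s2 s1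
  inum-221>0 = subst (0 <_) (sym inum-221) (val>0 s2)

  module HigmanianColourGraph (adj : Fin v → Fin v → Bool) (Λ : Fin 5 → ℕ)
    (common : ∀ x y → commonNbrs adj x y ≡ Λ (col x y)) where
    open ColourGraph adj Λ common public

    ddg-shape : IsDDG adj → Λ s3 ≡ Λ s4 × (Λ s1 ≡ Λ s2 ⊎ Λ s2 ≡ Λ s3)
    ddg-shape (_ , λ₁ , λ₂ , _ , _ , cls , D) with λ₁ ℕ.≟ λ₂
    ... | yes λ₁≡λ₂ =
      trans (uniform s3 (λ ())) (sym (uniform s4 (λ ()))) , inj₁ (trans (uniform s1 (λ ())) (sym (uniform s2 (λ ()))))
      where
      open Canonical D
      uniform : ∀ t → t ≢ zero → Λ t ≡ λ₁
      uniform = Λ-uniform λ₁≡λ₂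
    ... | no λ₁≢λ₂ =
      outer-kinds (kind′ s3 (λ ())) (kind′ s4 (λ ()))
      , inner-kinds (kind′ s1 (λ ())) (kind′ s2 (λ ())) (kind′ s3 (λ ()))
      where
      open Canonical D
      kind′ : ∀ t → t ≢ zero → Kind t
      kind′ = kind λ₁≢λ₂

      same-j⇒same-2 : ∀ {j} → Outer j → SameClass cls j → SameClass cls s2
      same-j⇒same-2 oj same-j = SameClass-closed (inum-jj2>0 oj) same-j same-j

      same-j⇒same-other : ∀ {j} → Outer j → SameClass cls j → SameClass cls (other j)
      same-j⇒same-other oj same-j = SameClass-closed (inum-j2-other>0 oj) same-j (same-j⇒same-2 oj same-j)

      same-2⇒same-1 : SameClass cls s2 → SameClass cls s1
      same-2⇒same-1 same-2 = SameClass-closed inum-221>0 same-2 same-2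

      outer-kinds : Kind s3 → Kind s4 → Λ s3 ≡ Λ s4
      outer-kinds (same  _   Λ₃) (same  _   Λ₄) = trans Λ₃ (sym Λ₄)
      outer-kinds (split _   Λ₃) (split _   Λ₄) = trans Λ₃ (sym Λ₄)
      outer-kinds (same  S₃  _)  (split ¬S₄ _)  = ⊥-elim (¬S₄ (same-j⇒same-other (inj₁ refl) S₃))
      outer-kinds (split ¬S₃ _)  (same  S₄  _)  = ⊥-elim (¬S₃ (same-j⇒same-other (inj₂ refl) S₄))

      inner-kinds : Kind s1 → Kind s2 → Kind s3 → Λ s1 ≡ Λ s2 ⊎ Λ s2 ≡ Λ s3
      inner-kinds (same  _   Λ₁) (same  _   Λ₂) _              = inj₁ (trans Λ₁ (sym Λ₂))
      inner-kinds (split ¬S₁ _)  (same  S₂  _)  _              = ⊥-elim (¬S₁ (same-2⇒same-1 S₂))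
      inner-kinds _              (split ¬S₂ _)  (same  S₃  _)  = ⊥-elim (¬S₂ (same-j⇒same-2 (inj₁ refl) S₃))
      inner-kinds _              (split _   Λ₂) (split _   Λ₃) = inj₂ (trans Λ₂ (sym Λ₃))

    module _ (graph : IsGraph adj) {deg} (regular : ∀ x → count (adj x) ≡ deg) where

      e1-DDG : Λ s1 ≡ Λ s2 → Λ s3 ≡ Λ s4 → DDGOn inE1 deg (Λ s1) (Λ s3)
      e1-DDG Λ₁≡Λ₂ Λ₃≡Λ₄ = parabolic-DDG graph regular inE1 e1-parabolic inside outside
        where
        inside : ∀ {t} → t ≢ zero → T (inE1 t) → Λ t ≡ Λ s1
        inside {zero}             t≢0 _ = ⊥-elim (t≢0 refl)
        inside {suc zero}         _   _ = refl
        inside {suc (suc zero)}   _   _ = sym Λ₁≡Λ₂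
        outside : ∀ {t} → ¬ T (inE1 t) → Λ t ≡ Λ s3
        outside {t} t∉e1 with ∉e1⇒outer t t∉e1
        ... | inj₁ refl = refl
        ... | inj₂ refl = sym Λ₃≡Λ₄

      e0-DDG : Λ s2 ≡ Λ s3 → Λ s3 ≡ Λ s4 → DDGOn inE0 deg (Λ s1) (Λ s2)
      e0-DDG Λ₂≡Λ₃ Λ₃≡Λ₄ = parabolic-DDG graph regular inE0 e0-parabolic inside outside
        where
        inside : ∀ {t} → t ≢ zero → T (inE0 t) → Λ t ≡ Λ s1
        inside {zero}     t≢0 _ = ⊥-elim (t≢0 refl)
        inside {suc zero} _   _ = refl
        outside : ∀ {t} → ¬ T (inE0 t) → Λ t ≡ Λ s2
        outside {zero}                         t∉e0 = ⊥-elim (t∉e0 tt)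
        outside {suc zero}                     t∉e0 = ⊥-elim (t∉e0 tt)
        outside {suc (suc zero)}               _    = refl
        outside {suc (suc (suc zero))}         _    = sym Λ₂≡Λ₃
        outside {suc (suc (suc (suc zero)))}   _    = sym (trans Λ₂≡Λ₃ Λ₃≡Λ₄)

-- The graph Γ with edge set s2 ∪ si

module Γ {v : ℕ} (X : AssocScheme v 4) (H : IsHigmanianStd X) {i : Fin 5} (oi : Outer i) where
  open AssocScheme X
  open IsHigmanianStd H
  open Higmanian X H

  s2≢i : s2 ≢ i
  s2≢i = e1≢outer tt oi

  Λ : Fin 5 → ℕ
  Λ t = inum s2 s2 t + inum s2 i t + inum i s2 t + inum i i t

  open HigmanianColourGraph (s2 ∪ i) Λ (∪-common s2≢i) public

  graph : IsGraph (s2 ∪ i)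
  graph = loopless , λ x y → cong (λ c → (c == s2) ∨ (c == i)) (symmetric x y)
    where
    loopless : ∀ x → (s2 ∪ i) x x ≡ false
    loopless x rewrite from (diag x x) refl = dec-false (zero ≟ i) (e1≢outer tt oi)

  regular : ∀ x → count ((s2 ∪ i) x) ≡ val s2 + val i
  regular = ∪-regular s2≢i

  Λ-e1 : ∀ {t} → T (inE1 t) → Λ t ≡ inum s2 s2 t + inum i i t
  Λ-e1 {t} t∈e1 = begin
    inum s2 s2 t + inum s2 i t + inum i s2 t + inum i i t
      ≡⟨ cong₂ (λ a b → inum s2 s2 t + a + b + inum i i t) cross (trans (inum-sym i s2 t) cross) ⟩
    inum s2 s2 t + 0 + 0 + inum i i t
      ≡⟨ cong (_+ inum i i t) (trans (+-identityʳ _) (+-identityʳ _)) ⟩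
    inum s2 s2 t + inum i i t
      ∎
    where
    open ≡-Reasoning
    cross : inum s2 i t ≡ 0
    cross = E1.inum-escape tt (outer∉e1 oi) t∈e1

  Λ-s1 : Λ s1 ≡ val s2 + inum i i s1
  Λ-s1 = trans (Λ-e1 tt) (cong (_+ inum i i s1) inum-221)

  Λ-s2 : Λ s2 + (1 + val s1) ≡ val s2 + inum i i s2
  Λ-s2 = begin
    Λ s2 + (1 + val s1)                          ≡⟨ cong (_+ (1 + val s1)) (Λ-e1 tt) ⟩
    inum s2 s2 s2 + inum i i s2 + (1 + val s1)   ≡⟨ +-assoc (inum s2 s2 s2) _ _ ⟩
    inum s2 s2 s2 + (inum i i s2 + (1 + val s1)) ≡⟨ cong (inum s2 s2 s2 +_) (+-comm (inum i i s2) _) ⟩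
    inum s2 s2 s2 + ((1 + val s1) + inum i i s2) ≡⟨ +-assoc (inum s2 s2 s2) _ _ ⟨
    inum s2 s2 s2 + (1 + val s1) + inum i i s2   ≡⟨ cong (_+ inum i i s2) inum-222 ⟩
    val s2 + inum i i s2                         ∎
    where open ≡-Reasoning

  Λ-outer : ∀ {t} → Outer t → Λ t ≡ 2 * d i + inum i i t
  Λ-outer {t} ot = begin
    inum s2 s2 t + inum s2 i t + inum i s2 t + inum i i t
      ≡⟨ cong₂ (λ a b → a + b + inum i s2 t + inum i i t) (E1.inum-closed tt tt (outer∉e1 ot)) (inum-2j-outer oi ot) ⟩
    d i + inum i s2 t + inum i i t
      ≡⟨ cong (λ a → d i + a + inum i i t) (trans (inum-sym i s2 t) (inum-2j-outer oi ot)) ⟩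
    d i + d i + inum i i t
      ≡⟨ cong (λ a → d i + a + inum i i t) (+-identityʳ (d i)) ⟨
    2 * d i + inum i i t
      ∎
    where open ≡-Reasoning

  N>0 : 0 < val i + val (other i)
  N>0 = ≤-trans (val>0 i) (m≤m+n (val i) (val (other i)))

  N*βᵢ : (val i + val (other i)) * β i ≡ val i * (1 + val s1)
  N*βᵢ = trans (cong (_* β i) (val-sum oi)) (N*β oi)

  N*αᵢ : (val i + val (other i)) * α i ≡ val i * (1 + val s1 + val s2)
  N*αᵢ = trans (cong (_* α i) (val-sum oi)) (N*α oi)

  open IntersectionArithmetic (val i) (val (other i)) (val s1) (val s2) (β i) (α i) N*βᵢ N*αᵢ

  N*c₂ᵢ : (val i + val (other i)) * inum i i s2 ≡ val i * val i
  N*c₂ᵢ = N*c₂ (val>0 s2) (e0-weights i) (e1-weights i)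

  Λ₁≡Λ₂⇔A : (Λ s1 ≡ Λ s2) ⇔ CondA X
  Λ₁≡Λ₂⇔A = begin
    (Λ s1 ≡ Λ s2)
      ≈⟨ +-cancelʳ-⇔ (1 + val s1) ⟩
    (Λ s1 + (1 + val s1) ≡ Λ s2 + (1 + val s1))
      ≈⟨ ≡-subst-⇔ (trans (cong (_+ (1 + val s1)) Λ-s1) (+-assoc (val s2) _ _)) Λ-s2 ⟩
    (val s2 + (inum i i s1 + (1 + val s1)) ≡ val s2 + inum i i s2)
      ≈⟨ +-cancelˡ-⇔ (val s2) ⟨
    (inum i i s1 + (1 + val s1) ≡ inum i i s2)
      ≈⟨ condA-arith N>0 (val>0 s1) (e0-weights i) N*c₂ᵢ ⟩
    ((val i + val (other i)) * (val s1 * (val s1 + 1)) ≡ val i * val (other i))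
      ≈⟨ ≡-subst-⇔ (cong (_* (val s1 * (val s1 + 1))) (val-sum oi)) (val-product oi) ⟩
    (N * (val s1 * (val s1 + 1)) ≡ val s3 * val s4)
      ≈⟨ condA⇔ (val>0 s1) (val>0 s3) (val>0 s4) ⟨
    CondA X
      ∎
    where open ⇔-Reasoning

  Λ₃≡Λ₄⇔cᵢᵢ : (Λ s3 ≡ Λ s4) ⇔ (inum i i s3 ≡ inum i i s4)
  Λ₃≡Λ₄⇔cᵢᵢ = ⇔-trans (≡-subst-⇔ (Λ-outer (inj₁ refl)) (Λ-outer (inj₂ refl))) (⇔-sym (+-cancelˡ-⇔ (2 * d i)))

  Λ₃≡Λ₄⇔c₃₃ : (Λ s3 ≡ Λ s4) ⇔ (inum s3 s3 s3 ≡ inum s3 s3 s4)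
  Λ₃≡Λ₄⇔c₃₃ = ⇔-trans Λ₃≡Λ₄⇔cᵢᵢ (inum-ii-balanced oi)

  N*c₃+nᵢ*α : inum i i s3 ≡ inum i i s4 → (val i + val (other i)) * inum i i s3 + val i * α i ≡ val i * val i
  N*c₃+nᵢ*α c₃≡c₄ = begin
    (val i + val (other i)) * inum i i s3 + val i * α i
      ≡⟨ cong (λ n → n * inum i i s3 + val i * α i) (val-sum oi) ⟩
    (val s3 + val s4) * inum i i s3 + val i * α i
      ≡⟨ cong (_+ val i * α i) (*-distribʳ-+ (inum i i s3) (val s3) (val s4)) ⟩
    val s3 * inum i i s3 + val s4 * inum i i s3 + val i * α i
      ≡⟨ cong (λ c → val s3 * inum i i s3 + val s4 * c + val i * α i) c₃≡c₄ ⟩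
    val s3 * inum i i s3 + val s4 * inum i i s4 + val i * α i
      ≡⟨ +-comm (val s3 * inum i i s3 + val s4 * inum i i s4) _ ⟩
    val i * α i + (val s3 * inum i i s3 + val s4 * inum i i s4)
      ≡⟨ +-assoc (val i * α i) _ _ ⟨
    val i * α i + val s3 * inum i i s3 + val s4 * inum i i s4
      ≡⟨ all-weights i ⟩
    val i * val i
      ∎
    where open ≡-Reasoning

  Λ₂≡Λ₃⇔B : Λ s3 ≡ Λ s4 → (Λ s2 ≡ Λ s3) ⇔ CondB X i
  Λ₂≡Λ₃⇔B Λ₃≡Λ₄ = begin
    (Λ s2 ≡ Λ s3)
      ≈⟨ +-cancelʳ-⇔ (1 + val s1) ⟩
    (Λ s2 + (1 + val s1) ≡ Λ s3 + (1 + val s1))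
      ≈⟨ ≡-subst-⇔ Λ-s2 (cong (_+ (1 + val s1)) (Λ-outer (inj₁ refl))) ⟩
    (val s2 + inum i i s2 ≡ 2 * d i + inum i i s3 + (1 + val s1))
      ≈⟨ condB-arith N>0 (val>0 (other i)) N*c₂ᵢ (trans (cong (_* d i) (val-sum oi)) (N*d oi))
                     (N*c₃+nᵢ*α (to Λ₃≡Λ₄⇔cᵢᵢ Λ₃≡Λ₄)) ⟩
    (val s2 * val (other i) ≡ (val s1 + 1) * val (other i) + 2 * val i * (val s1 + 1))
      ≈⟨ condB⇔ {val s1} {val s2} {val i} (val>0 (other i)) ⟨
    CondB X i
      ∎
    where open ⇔-Reasoning

  DDG-Λ⇔ : IsDDG (s2 ∪ i) ⇔ (Λ s3 ≡ Λ s4 × (Λ s1 ≡ Λ s2 ⊎ Λ s2 ≡ Λ s3))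
  DDG-Λ⇔ = mk⇔ ddg-shape λ where
    (Λ₃≡Λ₄ , inj₁ Λ₁≡Λ₂) → DDGOn⇒IsDDG {inE1} (e1-DDG graph regular Λ₁≡Λ₂ Λ₃≡Λ₄)
    (Λ₃≡Λ₄ , inj₂ Λ₂≡Λ₃) → DDGOn⇒IsDDG {inE0} (e0-DDG graph regular Λ₂≡Λ₃ Λ₃≡Λ₄)

  Λ-constant : Λ s1 ≡ Λ s2 → Λ s2 ≡ Λ s3 → Λ s3 ≡ Λ s4 → ∀ {t} → t ≢ zero → Λ t ≡ Λ s1
  Λ-constant _     _     _     {zero}                       t≢0 = ⊥-elim (t≢0 refl)
  Λ-constant _     _     _     {suc zero}                   _   = refl
  Λ-constant Λ₁≡Λ₂ _     _     {suc (suc zero)}             _   = sym Λ₁≡Λ₂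
  Λ-constant Λ₁≡Λ₂ Λ₂≡Λ₃ _     {suc (suc (suc zero))}       _   = sym (trans Λ₁≡Λ₂ Λ₂≡Λ₃)
  Λ-constant Λ₁≡Λ₂ Λ₂≡Λ₃ Λ₃≡Λ₄ {suc (suc (suc (suc zero)))} _   = sym (trans Λ₁≡Λ₂ (trans Λ₂≡Λ₃ Λ₃≡Λ₄))

  ProperDDG⇒Λ : IsProperDDG (s2 ∪ i) →
    Λ s3 ≡ Λ s4 × ((Λ s1 ≡ Λ s2 × Λ s2 ≢ Λ s3) ⊎ (Λ s2 ≡ Λ s3 × Λ s1 ≢ Λ s2))
  ProperDDG⇒Λ proper with ddg-shape (IsProperDDG⇒IsDDG proper)
  ... | Λ₃≡Λ₄ , inj₁ Λ₁≡Λ₂ =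
    Λ₃≡Λ₄ , inj₁ (Λ₁≡Λ₂ , λ Λ₂≡Λ₃ → IsProperDDG⇒nonconstant proper (Λ-constant Λ₁≡Λ₂ Λ₂≡Λ₃ Λ₃≡Λ₄))
  ... | Λ₃≡Λ₄ , inj₂ Λ₂≡Λ₃ =
    Λ₃≡Λ₄ , inj₂ (Λ₂≡Λ₃ , λ Λ₁≡Λ₂ → IsProperDDG⇒nonconstant proper (Λ-constant Λ₁≡Λ₂ Λ₂≡Λ₃ Λ₃≡Λ₄))

  Λ⇒ProperDDG : Λ s3 ≡ Λ s4 × ((Λ s1 ≡ Λ s2 × Λ s2 ≢ Λ s3) ⊎ (Λ s2 ≡ Λ s3 × Λ s1 ≢ Λ s2)) →
    IsProperDDG (s2 ∪ i)
  Λ⇒ProperDDG (Λ₃≡Λ₄ , inj₁ (Λ₁≡Λ₂ , Λ₂≢Λ₃)) =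
    DDGOn⇒IsProperDDG {inE1} (e1-DDG graph regular Λ₁≡Λ₂ Λ₃≡Λ₄) {s3} (λ ())
      (subst (1 <_) (sym valency-e1) (s≤s (≤-trans (val>0 s1) (m≤m+n (val s1) (val s2)))))
      (λ Λ₁≡Λ₃ → Λ₂≢Λ₃ (trans (sym Λ₁≡Λ₂) Λ₁≡Λ₃))
  Λ⇒ProperDDG (Λ₃≡Λ₄ , inj₂ (Λ₂≡Λ₃ , Λ₁≢Λ₂)) =
    DDGOn⇒IsProperDDG {inE0} (e0-DDG graph regular Λ₂≡Λ₃ Λ₃≡Λ₄) {s3} (λ ())
      (subst (1 <_) (sym valency-e0) (s≤s (val>0 s1)))
      Λ₁≢Λ₂

  ProperDDG-Λ⇔ : IsProperDDG (s2 ∪ i) ⇔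
    (Λ s3 ≡ Λ s4 × ((Λ s1 ≡ Λ s2 × Λ s2 ≢ Λ s3) ⊎ (Λ s2 ≡ Λ s3 × Λ s1 ≢ Λ s2)))
  ProperDDG-Λ⇔ = mk⇔ ProperDDG⇒Λ Λ⇒ProperDDG

  Λ-conditions⇔ : (Λ s3 ≡ Λ s4 × (Λ s1 ≡ Λ s2 ⊎ Λ s2 ≡ Λ s3)) ⇔
    (inum s3 s3 s3 ≡ inum s3 s3 s4 × (CondA X ⊎ CondB X i))
  Λ-conditions⇔ = mk⇔
    (λ (Λ₃≡Λ₄ , shape) → to Λ₃≡Λ₄⇔c₃₃ Λ₃≡Λ₄ , Sum.map (to Λ₁≡Λ₂⇔A) (to (Λ₂≡Λ₃⇔B Λ₃≡Λ₄)) shape)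
    (λ (C , A⊎B) → let Λ₃≡Λ₄ = from Λ₃≡Λ₄⇔c₃₃ C in
      Λ₃≡Λ₄ , Sum.map (from Λ₁≡Λ₂⇔A) (from (Λ₂≡Λ₃⇔B Λ₃≡Λ₄)) A⊎B)

  Λ-proper-conditions⇔ : (Λ s3 ≡ Λ s4 × ((Λ s1 ≡ Λ s2 × Λ s2 ≢ Λ s3) ⊎ (Λ s2 ≡ Λ s3 × Λ s1 ≢ Λ s2))) ⇔
    (inum s3 s3 s3 ≡ inum s3 s3 s4 × ((CondA X × ¬ CondB X i) ⊎ (CondB X i × ¬ CondA X)))
  Λ-proper-conditions⇔ = mk⇔
    (λ (Λ₃≡Λ₄ , shape) → to Λ₃≡Λ₄⇔c₃₃ Λ₃≡Λ₄ , Sum.map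
      (λ (Λ₁≡Λ₂ , Λ₂≢Λ₃) → to Λ₁≡Λ₂⇔A Λ₁≡Λ₂ , Λ₂≢Λ₃ ∘ from (Λ₂≡Λ₃⇔B Λ₃≡Λ₄))
      (λ (Λ₂≡Λ₃ , Λ₁≢Λ₂) → to (Λ₂≡Λ₃⇔B Λ₃≡Λ₄) Λ₂≡Λ₃ , Λ₁≢Λ₂ ∘ from Λ₁≡Λ₂⇔A) shape)
    (λ (C , conditions) → let Λ₃≡Λ₄ = from Λ₃≡Λ₄⇔c₃₃ C in Λ₃≡Λ₄ , Sum.map
      (λ (A , ¬B) → from Λ₁≡Λ₂⇔A A , ¬B ∘ to (Λ₂≡Λ₃⇔B Λ₃≡Λ₄))
      (λ (B , ¬A) → from (Λ₂≡Λ₃⇔B Λ₃≡Λ₄) B , ¬A ∘ to Λ₁≡Λ₂⇔A) conditions)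

theorem1 : ∀ {v : ℕ} (X : AssocScheme v 4) → IsHigmanianStd X →
    (i : Fin 5) → (i ≡ s3 ⊎ i ≡ s4) →
    ((IsDDG (gammaAdj X i) ⇔
        ((AssocScheme.inum X s3 s3 s3 ≡ AssocScheme.inum X s3 s3 s4) ×
         (CondA X ⊎ CondB X i)))
    × (IsDDG (gammaAdj X i) → CondA X →
         IsDDGPart (gammaAdj X i) (λ x y → T (inE1 (AssocScheme.col X x y))))
    × (IsDDG (gammaAdj X i) → CondB X i →
         IsDDGPart (gammaAdj X i) (λ x y → T (inE0 (AssocScheme.col X x y))))
    × (IsProperDDG (gammaAdj X i) ⇔
        ((AssocScheme.inum X s3 s3 s3 ≡ AssocScheme.inum X s3 s3 s4) ×
         ((CondA X × ¬ CondB X i) ⊎ (CondB X i × ¬ CondA X)))))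
theorem1 X H i oi =
    ⇔-trans DDG-Λ⇔ Λ-conditions⇔
  , (λ ddg A → DDGOn⇒IsDDGPart {inE1} (e1-DDG graph regular (from Λ₁≡Λ₂⇔A A) (proj₁ (ddg-shape ddg))))
  , (λ ddg B → let Λ₃≡Λ₄ = proj₁ (ddg-shape ddg) in
       DDGOn⇒IsDDGPart {inE0} (e0-DDG graph regular (from (Λ₂≡Λ₃⇔B Λ₃≡Λ₄) B) Λ₃≡Λ₄))
  , ⇔-trans ProperDDG-Λ⇔ Λ-proper-conditions⇔
  where open Γ X H oi
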